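{- Let $p$ be a prime, $k$ a positive integer and $\gamma,\gamma_1,\gamma_2$ $p^k$-symbols with $\mathrm{ord}_p(\gamma)=\mathrm{ord}_p(\gamma_1)=\mathrm{ord}_p(\gamma_2)=i<k$. Fix $t$ with $\mathrm{sym}_{p^k}(t)=\gamma$ and let $N$ be the number of pairs $(a,b)\in(\mathbb{Z}/p^k\mathbb{Z})^2$ with $\mathrm{sym}_{p^k}(a)=\gamma_1$, $\mathrm{sym}_{p^k}(b)=\gamma_2$ and $a+b\equiv t\pmod{p^k}$. If $p=2$ then $N=0$. If $p$ is odd then, writing $s=\mathrm{sgn}_p(\gamma)$, $s_1=\mathrm{sgn}_p(\gamma_1)$, $s_2=\mathrm{sgn}_p(\gamma_2)$, $$N=p^{k-i-1}\cdot\frac14\Big(p-(p\bmod 4)-\big(s_1+s_2\big)\big(\left(\tfrac{ -1}{p}\right)s_1+s\big)\Big).$$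
   Context: $\mathrm{ord}_p(a)$ is the largest $e$ with $p^e\mid a$ ($\mathrm{ord}_p(0)=\infty$); $\mathrm{cop}_p(a)=a/p^{\mathrm{ord}_p(a)}$. $\mathrm{sgn}_p(0)=0$; for $a\ne0$, $\mathrm{sgn}_p(a)=\left(\frac{\mathrm{cop}_p(a)}{p}\right)$ (Legendre symbol) if $p$ odd and $\mathrm{cop}_2(a)\bmod 8$ if $p=2$. $\mathrm{sym}_{p^k}(t)=(\mathrm{ord}_p(t\bmod p^k),\mathrm{sgn}_p(t\bmod p^k))$ with $t\bmod p^k\in\{0,\dots,p^k-1\}$; a $p^k$-symbol is a value $\gamma$ of $\mathrm{sym}_{p^k}$, and $\mathrm{ord}_p(\gamma)$, $\mathrm{sgn}_p(\gamma)$ denote its two components. -}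

module Defs where

open import Data.Nat using (ℕ; zero; suc; _+_; _*_; _^_; _%_; _/_; _≟_)
open import Data.Integer as ℤ using (ℤ; +_; -[1+_]; _%ℕ_)
import Data.Integer.Properties as ℤP
open import Data.Bool using (Bool; true; false; if_then_else_)
open import Data.Bool.ListAction using (any)
open import Data.List using (List; upTo; length; filter; cartesianProduct)
open import Data.Product using (_×_; _,_; proj₁; proj₂; ∃)
open import Data.Product.Properties using (≡-dec)
open import Relation.Nullary using (Dec; yes; no; does)
open import Relation.Nullary.Decidable using (_×-dec_)
open import Relation.Binary.PropositionalEquality using (_≡_; refl)

data Ord : Set where
  fin : ℕ → Ord
  ∞   : Ord

-- ord_p(a) for a ≠ 0, by recursion with fuel (fuel a suffices for p ≥ 2)
ordF : ℕ → ℕ → ℕ → ℕ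
ordF zero    p       a = 0
ordF (suc f) zero    a = 0
ordF (suc f) (suc q) a = if does (a % suc q ≟ 0) then suc (ordF f (suc q) (a / suc q)) else 0

-- cop_p(a) = a / p^ord_p(a), for a ≠ 0
copF : ℕ → ℕ → ℕ → ℕ
copF zero    p       a = a
copF (suc f) zero    a = a
copF (suc f) (suc q) a = if does (a % suc q ≟ 0) then copF f (suc q) (a / suc q) else a

ord : ℕ → ℕ → Ord
ord p zero    = ∞
ord p (suc a) = fin (ordF (suc a) p (suc a))

cop : ℕ → ℕ → ℕ
cop p a = copF a p a

legendre : ℕ → ℕ → ℤ
legendre zero    a = + 0
legendre (suc q) a =
  if does (a % suc q ≟ 0) then + 0
  else (if any (λ x → does ((x * x) % suc q ≟ a % suc q)) (upTo (suc q)) then + 1 else -[1+ 0 ])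

sgn : ℕ → ℕ → ℤ
sgn p zero = + 0
sgn p (suc a) = if does (p ≟ 2) then + (cop p (suc a) % 8) else legendre p (cop p (suc a))

modPK : ℕ → ℕ → ℤ → ℕ
modPK p k t with p ^ k
... | zero  = 0
... | suc m = t %ℕ suc m

Symbol : Set
Symbol = Ord × ℤ

ordS : Symbol → Ord
ordS = proj₁

sgnS : Symbol → ℤ
sgnS = proj₂

sym : ℕ → ℕ → ℤ → Symbol
sym p k t = ord p (modPK p k t) , sgn p (modPK p k t)

IsSymbol : ℕ → ℕ → Symbol → Set
IsSymbol p k γ = ∃ λ (t : ℤ) → sym p k t ≡ γ

_≟O_ : (x y : Ord) → Dec (x ≡ y)
fin m ≟O fin n with m ≟ n
... | yes refl = yes refl
... | no ne = no λ { refl → ne refl }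
fin m ≟O ∞ = no λ ()
∞ ≟O fin n = no λ ()
∞ ≟O ∞ = yes refl

_≟S_ : (x y : Symbol) → Dec (x ≡ y)
_≟S_ = ≡-dec _≟O_ ℤP._≟_

-- N: number of (a, b) ∈ (ℤ/p^kℤ)², represented by 0 ≤ a, b < p^k, with
-- sym(a) = γ₁, sym(b) = γ₂ and a + b ≡ t (mod p^k)
countPairs : ℕ → ℕ → ℤ → Symbol → Symbol → ℕ
countPairs p k t γ₁ γ₂ =
  length (filter (λ ab → ((sym p k (+ proj₁ ab) ≟S γ₁) ×-dec (sym p k (+ proj₂ ab) ≟S γ₂))
                           ×-dec (modPK p k (+ (proj₁ ab + proj₂ ab)) ≟ modPK p k t))
                 (cartesianProduct (upTo (p ^ k)) (upTo (p ^ k))))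

module Submission where

-- Write Q = p^k, M = p^i and m = p M.  For x < Q, sym(x) = (i, s) exactly when x % m = u M
-- with χ(u) = s, χ the Legendre symbol.  Since b ≡ t − a is determined by a, the count
-- depends only on a % m and equals p^(k−i−1) · N, where N counts the r < p with χ(r) = s₁ and
-- χ(w − r) = s₂, w being the i-th digit of t.  Writing 2·[χ(x) = s] = χ(x)² + s χ(x) turns 4N
-- into character sums: Σ χ = 0 and, for w ≢ 0, the Jacobi sum Σ χ(r) χ(w − r) = −χ(−1).  That
-- N(−1, −1, 1) is an integer forces p ≡ χ(−1) (mod 4), which gives the stated formula.
-- Multiplicativity of χ is derived from its definition: Σ χ = 0 by counting square roots, and
-- multiplication by a unit permutes the residues, so it preserves or flips every value of χ.
-- For p = 2 the cofactors of a and b are odd, so 2M divides a + b but not t.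

module FiniteSums where

  open import Data.Nat as ℕ using (ℕ; zero; suc; _<_; z≤n; s≤s; NonZero)
  import Data.Nat.Properties as ℕ
  open import Data.Nat.DivMod using (_%_; m<n⇒m%n≡m; [m+n]%n≡m%n)
  open import Data.Integer using (ℤ; +_; _+_; _*_; _-_; _≤_; +≤+; -[1+_])
  import Data.Integer.Properties as ℤ
  open import Data.Integer.Tactic.RingSolver using (solve-∀)
  open import Data.Fin as Fin using (Fin; toℕ)
  import Data.Fin.Properties as Fin
  open import Data.Fin.Permutation using (Permutation)
  open import Data.Product using (_×_; _,_; proj₁; proj₂; ∃)
  open import Data.Empty using (⊥-elim)
  open import Data.Bool using (if_then_else_)
  open import Relation.Nullary using (Dec; yes; no; does; ¬_)
  open import Relation.Nullary.Decidable using (_×-dec_)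
  open import Relation.Binary.PropositionalEquality
  open import Function using (_∘_)
  open import Function.Bundles using (mk↔ₛ′)
  open import Algebra.Properties.CommutativeMonoid.Sum ℤ.+-0-commutativeMonoid
    using (sum; sum-permute)

  ∑< : ℕ → (ℕ → ℤ) → ℤ
  ∑< zero    f = + 0
  ∑< (suc n) f = f 0 + ∑< n (f ∘ suc)

  infix 5 ∑<
  syntax ∑< n (λ r → e) = ∑[ r < n ] e

  𝟙 : ∀ {a} {A : Set a} → Dec A → ℤ
  𝟙 d = if does d then + 1 else + 0

  module _ {a} {A : Set a} where

    𝟙-yes : (d : Dec A) → A → 𝟙 d ≡ + 1
    𝟙-yes (yes _) _ = refl
    𝟙-yes (no ¬x) x = ⊥-elim (¬x x)

    𝟙-no : (d : Dec A) → ¬ A → 𝟙 d ≡ + 0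
    𝟙-no (yes x) ¬x = ⊥-elim (¬x x)
    𝟙-no (no _)  _  = refl

    𝟙-cong : ∀ {b} {B : Set b} (d : Dec A) (e : Dec B) → (A → B) → (B → A) → 𝟙 d ≡ 𝟙 e
    𝟙-cong (yes _) (yes _) _ _ = refl
    𝟙-cong (yes x) (no ¬y) f _ = ⊥-elim (¬y (f x))
    𝟙-cong (no ¬x) (yes y) _ g = ⊥-elim (¬x (g y))
    𝟙-cong (no _)  (no _)  _ _ = refl

    𝟙-× : ∀ {b} {B : Set b} (d : Dec A) (e : Dec B) → 𝟙 (d ×-dec e) ≡ 𝟙 d * 𝟙 e
    𝟙-× (yes _) (yes _) = refl
    𝟙-× (yes _) (no _)  = refl
    𝟙-× (no _)  (yes _) = refl
    𝟙-× (no _)  (no _)  = refl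

  ∑-cong : ∀ n {f g : ℕ → ℤ} → (∀ r → r < n → f r ≡ g r) → ∑< n f ≡ ∑< n g
  ∑-cong zero    _ = refl
  ∑-cong (suc n) h = cong₂ _+_ (h 0 (s≤s z≤n)) (∑-cong n (λ r r<n → h (suc r) (s≤s r<n)))

  ∑-distrib-+ : ∀ n (f g : ℕ → ℤ) → ∑[ r < n ] f r + g r ≡ ∑< n f + ∑< n g
  ∑-distrib-+ zero    f g = refl
  ∑-distrib-+ (suc n) f g =
    trans (cong (_+_ (f 0 + g 0)) (∑-distrib-+ n (f ∘ suc) (g ∘ suc)))
          (interchange (f 0) (g 0) (∑< n (f ∘ suc)) (∑< n (g ∘ suc)))
    where
    interchange : ∀ (a b c d : ℤ) → (a + b) + (c + d) ≡ (a + c) + (b + d)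
    interchange = solve-∀

  ∑-*ˡ : ∀ n (c : ℤ) (f : ℕ → ℤ) → ∑[ r < n ] c * f r ≡ c * ∑< n f
  ∑-*ˡ zero    c f = sym (ℤ.*-zeroʳ c)
  ∑-*ˡ (suc n) c f = trans (cong (_+_ (c * f 0)) (∑-*ˡ n c (f ∘ suc)))
                           (sym (ℤ.*-distribˡ-+ c (f 0) (∑< n (f ∘ suc))))

  ∑-linear : ∀ n (f : ℕ → ℤ) c (g : ℕ → ℤ) → ∑[ r < n ] f r + c * g r ≡ ∑< n f + c * ∑< n g
  ∑-linear n f c g = trans (∑-distrib-+ n f (λ r → c * g r)) (cong (_+_ (∑< n f)) (∑-*ˡ n c g))

  ∑-const : ∀ n (c : ℤ) → ∑[ r < n ] c ≡ + n * c
  ∑-const zero    c = sym (ℤ.*-zeroˡ c)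
  ∑-const (suc n) c = trans (cong (_+_ c) (∑-const n c)) (sym (ℤ.suc-* (+ n) c))

  ∑-zero : ∀ n → ∑[ r < n ] + 0 ≡ + 0
  ∑-zero n = trans (∑-const n (+ 0)) (ℤ.*-zeroʳ (+ n))

  ∑-vanishing : ∀ n {f : ℕ → ℤ} → (∀ r → r < n → f r ≡ + 0) → ∑< n f ≡ + 0
  ∑-vanishing n h = trans (∑-cong n h) (∑-zero n)

  ∑-one : ∀ n → ∑[ r < n ] + 1 ≡ + n
  ∑-one n = trans (∑-const n (+ 1)) (ℤ.*-identityʳ (+ n))

  ∑-+-split : ∀ a b (f : ℕ → ℤ) → ∑< (a ℕ.+ b) f ≡ ∑< a f + (∑[ r < b ] f (a ℕ.+ r))
  ∑-+-split zero    b f = sym (ℤ.+-identityˡ _)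
  ∑-+-split (suc a) b f =
    trans (cong (_+_ (f 0)) (∑-+-split a b (f ∘ suc))) (sym (ℤ.+-assoc (f 0) _ _))

  ∑-comm : ∀ m n (f : ℕ → ℕ → ℤ) → ∑[ a < m ] ∑[ b < n ] f a b ≡ ∑[ b < n ] ∑[ a < m ] f a b
  ∑-comm zero    n f = sym (∑-zero n)
  ∑-comm (suc m) n f = trans (cong (_+_ (∑< n (f 0))) (∑-comm m n (f ∘ suc)))
                             (sym (∑-distrib-+ n (f 0) (λ b → ∑[ a < m ] f (suc a) b)))

  ∑-pick : ∀ n c (g : ℕ → ℤ) → c < n → ∑[ r < n ] g r * 𝟙 (r ℕ.≟ c) ≡ g c
  ∑-pick (suc n) zero g _ = begin
    g 0 * + 1 + (∑[ r < n ] g (suc r) * + 0)  ≡⟨ cong₂ _+_ (ℤ.*-identityʳ (g 0))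
                                                            (∑-vanishing n (λ r _ → ℤ.*-zeroʳ (g (suc r)))) ⟩
    g 0 + + 0                                  ≡⟨ ℤ.+-identityʳ (g 0) ⟩
    g 0                                        ∎
    where open ≡-Reasoning
  ∑-pick (suc n) (suc c) g (s≤s c<n) = begin
    g 0 * + 0 + (∑[ r < n ] g (suc r) * 𝟙 (suc r ℕ.≟ suc c))
      ≡⟨ cong₂ _+_ (ℤ.*-zeroʳ (g 0)) (∑-cong n (λ r _ → cong (g (suc r) *_) (𝟙-suc r))) ⟩
    + 0 + (∑[ r < n ] g (suc r) * 𝟙 (r ℕ.≟ c))
      ≡⟨ ℤ.+-identityˡ _ ⟩
    ∑[ r < n ] g (suc r) * 𝟙 (r ℕ.≟ c)
      ≡⟨ ∑-pick n c (g ∘ suc) c<n ⟩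
    g (suc c) ∎
    where
    open ≡-Reasoning
    𝟙-suc : ∀ r → 𝟙 (suc r ℕ.≟ suc c) ≡ 𝟙 (r ℕ.≟ c)
    𝟙-suc r = 𝟙-cong (suc r ℕ.≟ suc c) (r ℕ.≟ c) ℕ.suc-injective (cong suc)

  ∑-𝟙-≟ : ∀ n c → c < n → ∑[ r < n ] 𝟙 (r ℕ.≟ c) ≡ + 1
  ∑-𝟙-≟ n c c<n = trans (∑-cong n (λ r _ → sym (ℤ.*-identityˡ (𝟙 (r ℕ.≟ c))))) (∑-pick n c (λ _ → + 1) c<n)

  ∑-except : ∀ n c (f : ℕ → ℤ) → c < n → ∑[ r < n ] f r * (+ 1 - 𝟙 (r ℕ.≟ c)) ≡ ∑< n f - f c
  ∑-except n c f c<n = begin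
    ∑[ r < n ] f r * (+ 1 - 𝟙 (r ℕ.≟ c))                 ≡⟨ ∑-cong n (λ r _ → expand (f r) (𝟙 (r ℕ.≟ c))) ⟩
    ∑[ r < n ] f r + -[1+ 0 ] * (f r * 𝟙 (r ℕ.≟ c))        ≡⟨ ∑-linear n f -[1+ 0 ] (λ r → f r * 𝟙 (r ℕ.≟ c)) ⟩
    ∑< n f + -[1+ 0 ] * (∑[ r < n ] f r * 𝟙 (r ℕ.≟ c))    ≡⟨ cong (λ z → ∑< n f + -[1+ 0 ] * z) (∑-pick n c f c<n) ⟩
    ∑< n f + -[1+ 0 ] * f c                              ≡⟨ cong (_+_ (∑< n f)) (ℤ.-1*i≡-i (f c)) ⟩
    ∑< n f - f c                                         ∎
    where
    open ≡-Reasoning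
    expand : ∀ x i → x * (+ 1 - i) ≡ x + -[1+ 0 ] * (x * i)
    expand = solve-∀

  ∑-nonneg : ∀ n (f : ℕ → ℤ) → (∀ r → r < n → + 0 ≤ f r) → + 0 ≤ ∑< n f
  ∑-nonneg zero    f h = +≤+ z≤n
  ∑-nonneg (suc n) f h =
    ℤ.+-mono-≤ (h 0 (s≤s z≤n)) (∑-nonneg n (f ∘ suc) (λ r r<n → h (suc r) (s≤s r<n)))

  ∑-nonneg-≡0 : ∀ n (f : ℕ → ℤ) → (∀ r → r < n → + 0 ≤ f r) → ∑< n f ≡ + 0 →
                ∀ r → r < n → f r ≡ + 0
  ∑-nonneg-≡0 (suc n) f h sum≡0 r r<n = at r r<n
    where
    h-tail : ∀ r → r < n → + 0 ≤ f (suc r)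
    h-tail r r<n = h (suc r) (s≤s r<n)
    both-zero : ∀ x y → + 0 ≤ x → + 0 ≤ y → x + y ≡ + 0 → (x ≡ + 0) × (y ≡ + 0)
    both-zero (+ zero)  (+ zero)  _ _ _ = refl , refl
    both-zero (+ zero)  (+ suc _) _ _ ()
    both-zero (+ suc _) (+ _)     _ _ ()
    both-zero (+ _)     -[1+ _ ]  _ () _
    both-zero -[1+ _ ]  _         () _ _
    split : f 0 ≡ + 0 × ∑< n (f ∘ suc) ≡ + 0
    split = both-zero (f 0) (∑< n (f ∘ suc)) (h 0 (s≤s z≤n)) (∑-nonneg n (f ∘ suc) h-tail) sum≡0
    at : ∀ r → r < suc n → f r ≡ + 0
    at zero    _         = proj₁ split
    at (suc r) (s≤s r<n) = ∑-nonneg-≡0 n (f ∘ suc) h-tail (proj₂ split) r r<n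

  ∑-periodic : ∀ m .{{_ : NonZero m}} n (F : ℕ → ℤ) → ∑[ a < m ℕ.* n ] F (a % m) ≡ + n * ∑< m F
  ∑-periodic m zero F = trans (cong (λ x → ∑[ a < x ] F (a % m)) (ℕ.*-zeroʳ m)) (sym (ℤ.*-zeroˡ (∑< m F)))
  ∑-periodic m (suc n) F = begin
    ∑[ a < m ℕ.* suc n ] F (a % m)
      ≡⟨ cong (λ x → ∑[ a < x ] F (a % m)) (ℕ.*-suc m n) ⟩
    ∑[ a < m ℕ.+ m ℕ.* n ] F (a % m)
      ≡⟨ ∑-+-split m (m ℕ.* n) (λ a → F (a % m)) ⟩
    (∑[ a < m ] F (a % m)) + (∑[ r < m ℕ.* n ] F ((m ℕ.+ r) % m))
      ≡⟨ cong₂ _+_ (∑-cong m (λ a a<m → cong F (m<n⇒m%n≡m a<m))) (∑-cong (m ℕ.* n) (λ r _ → cong F (shift r))) ⟩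
    ∑< m F + (∑[ r < m ℕ.* n ] F (r % m))
      ≡⟨ cong (_+_ (∑< m F)) (∑-periodic m n F) ⟩
    ∑< m F + + n * ∑< m F
      ≡⟨ ℤ.suc-* (+ n) (∑< m F) ⟨
    + suc n * ∑< m F
      ∎
    where
    open ≡-Reasoning
    shift : ∀ r → (m ℕ.+ r) % m ≡ r % m
    shift r = trans (cong (_% m) (ℕ.+-comm m r)) ([m+n]%n≡m%n r m)

  ∑-multiples : ∀ M .{{_ : NonZero M}} n (G : ℕ → ℤ) → (∀ d → d % M ≢ 0 → G d ≡ + 0) →
                ∑< (n ℕ.* M) G ≡ ∑[ r < n ] G (r ℕ.* M)
  ∑-multiples M zero G h = refl
  ∑-multiples M@(suc M′) (suc n) G h = begin
    ∑< (M ℕ.+ n ℕ.* M) G                              ≡⟨ ∑-+-split M (n ℕ.* M) G ⟩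
    ∑< M G + (∑[ r < n ℕ.* M ] G (M ℕ.+ r))            ≡⟨ cong₂ _+_ first-block (∑-multiples M n (λ r → G (M ℕ.+ r)) h-shift) ⟩
    G 0 + (∑[ r < n ] G (M ℕ.+ r ℕ.* M))               ∎
    where
    open ≡-Reasoning
    first-block : ∑< M G ≡ G 0
    first-block = trans (cong (_+_ (G 0)) (∑-vanishing M′ (λ d d<M′ → h (suc d) (λ e →
                    0≢suc (trans (sym e) (m<n⇒m%n≡m (s≤s d<M′)))))))
                        (ℤ.+-identityʳ (G 0))
      where
      0≢suc : ∀ {d} → 0 ≢ suc d
      0≢suc ()
    h-shift : ∀ d → d % M ≢ 0 → G (M ℕ.+ d) ≡ + 0
    h-shift d ne = h (M ℕ.+ d) (λ e → ne (trans (sym ([m+n]%n≡m%n d M)) (trans (cong (_% M) (ℕ.+-comm d M)) e)))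

  injective⇒surjective : ∀ {n} (f : Fin n → Fin n) → (∀ x y → f x ≡ f y → x ≡ y) →
                         ∀ y → ∃ λ x → f x ≡ y
  injective⇒surjective {n} f inj y with Fin.any? (λ x → f x Fin.≟ y)
  ... | yes hit = hit
  injective⇒surjective {suc m} f inj y | no miss =
    ⊥-elim (ℕ.<-irrefl refl (Fin.injective⇒≤ {f = squeeze} squeeze-injective))
    where
    avoids : ∀ x → y ≢ f x
    avoids x eq = miss (x , sym eq)
    squeeze : Fin (suc m) → Fin m
    squeeze x = Fin.punchOut (avoids x)
    squeeze-injective : ∀ {x x′} → squeeze x ≡ squeeze x′ → x ≡ x′
    squeeze-injective {x} {x′} e = inj x x′ (Fin.punchOut-injective (avoids x) (avoids x′) e)

  ∑-reindex : ∀ n (π : ℕ → ℕ) → (∀ r → r < n → π r < n) →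
              (∀ r r′ → r < n → r′ < n → π r ≡ π r′ → r ≡ r′) →
              (g : ℕ → ℤ) → ∑[ r < n ] g (π r) ≡ ∑< n g
  ∑-reindex n π π<n π-inj g = begin
    ∑[ r < n ] g (π r)                ≡⟨ as-sum {n} (g ∘ π) ⟩
    sum {n} (λ i → g (π (toℕ i)))      ≡⟨ sum-cong {n} (λ i → cong g (Fin.toℕ-fromℕ< _)) ⟨
    sum {n} (λ i → g (toℕ (πᶠ i)))     ≡⟨ sum-permute (g ∘ toℕ) permutation ⟨
    sum {n} (λ i → g (toℕ i))          ≡⟨ as-sum {n} g ⟨
    ∑< n g                            ∎
    where
    open ≡-Reasoning
    as-sum : ∀ {n} (f : ℕ → ℤ) → ∑< n f ≡ sum {n} (f ∘ toℕ)
    as-sum {zero}  f = refl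
    as-sum {suc n} f = cong (_+_ (f 0)) (as-sum {n} (f ∘ suc))
    sum-cong : ∀ {m} {a b : Fin m → ℤ} → (∀ i → a i ≡ b i) → sum a ≡ sum b
    sum-cong {zero}  h = refl
    sum-cong {suc m} h = cong₂ _+_ (h Fin.zero) (sum-cong (h ∘ Fin.suc))
    πᶠ : Fin n → Fin n
    πᶠ i = Fin.fromℕ< (π<n (toℕ i) (Fin.toℕ<n i))
    πᶠ-injective : ∀ x y → πᶠ x ≡ πᶠ y → x ≡ y
    πᶠ-injective x y e = Fin.toℕ-injective (π-inj (toℕ x) (toℕ y) (Fin.toℕ<n x) (Fin.toℕ<n y)
      (trans (sym (Fin.toℕ-fromℕ< _)) (trans (cong toℕ e) (Fin.toℕ-fromℕ< _))))
    πᶠ⁻¹ : Fin n → Fin n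
    πᶠ⁻¹ y = proj₁ (injective⇒surjective πᶠ πᶠ-injective y)
    permutation : Permutation n n
    permutation = mk↔ₛ′ πᶠ πᶠ⁻¹ (λ y → proj₂ (injective⇒surjective πᶠ πᶠ-injective y))
                               (λ x → πᶠ-injective _ _ (proj₂ (injective⇒surjective πᶠ πᶠ-injective (πᶠ x))))

module ModularArithmetic where

  open import Data.Nat using (ℕ; zero; suc; _<_; _≤_; _+_; _*_; _∸_; NonZero; _<?_)
  open import Data.Nat.Properties
  open import Data.Nat.DivMod
  open import Data.Nat.Divisibility
  open import Data.Nat.Primality using (Prime; euclidsLemma)
  open import Data.Product using (_,_)
  open import Data.Sum using (_⊎_; inj₁; inj₂)
  open import Data.Empty using (⊥-elim)
  open import Relation.Nullary using (yes; no; ¬_)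
  open import Relation.Binary.PropositionalEquality

  module _ (n : ℕ) .{{_ : NonZero n}} where

    [m%n+o]%n≡[m+o]%n : ∀ m o → (m % n + o) % n ≡ (m + o) % n
    [m%n+o]%n≡[m+o]%n m o = begin
      (m % n + o) % n            ≡⟨ %-distribˡ-+ (m % n) o n ⟩
      (m % n % n + o % n) % n    ≡⟨ cong (λ z → (z + o % n) % n) (m%n%n≡m%n m n) ⟩
      (m % n + o % n) % n        ≡⟨ %-distribˡ-+ m o n ⟨
      (m + o) % n                ∎
      where open ≡-Reasoning

    [m+o%n]%n≡[m+o]%n : ∀ m o → (m + o % n) % n ≡ (m + o) % n
    [m+o%n]%n≡[m+o]%n m o = trans (cong (_% n) (+-comm m (o % n)))
                           (trans ([m%n+o]%n≡[m+o]%n o m) (cong (_% n) (+-comm o m)))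

    [m*o%n]%n≡[m*o]%n : ∀ m o → (m * (o % n)) % n ≡ (m * o) % n
    [m*o%n]%n≡[m*o]%n m o = begin
      (m * (o % n)) % n          ≡⟨ %-distribˡ-* m (o % n) n ⟩
      (m % n * (o % n % n)) % n  ≡⟨ cong (λ z → (m % n * z) % n) (m%n%n≡m%n o n) ⟩
      (m % n * (o % n)) % n      ≡⟨ %-distribˡ-* m o n ⟨
      (m * o) % n                ∎
      where open ≡-Reasoning

    -- Adding n ∸ c % n cancels c modulo n, so c may be removed from both sides.
    %-+-cancelʳ : ∀ a b c → (a + c) % n ≡ (b + c) % n → a % n ≡ b % n
    %-+-cancelʳ a b c e = begin
      a % n                      ≡⟨ %-remove-+ʳ a n∣c+c′ ⟨
      (a + (c + c′)) % n         ≡⟨ cong (_% n) (+-assoc a c c′) ⟨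
      (a + c + c′) % n           ≡⟨ [m%n+o]%n≡[m+o]%n (a + c) c′ ⟨
      ((a + c) % n + c′) % n     ≡⟨ cong (λ z → (z + c′) % n) e ⟩
      ((b + c) % n + c′) % n     ≡⟨ [m%n+o]%n≡[m+o]%n (b + c) c′ ⟩
      (b + c + c′) % n           ≡⟨ cong (_% n) (+-assoc b c c′) ⟩
      (b + (c + c′)) % n         ≡⟨ %-remove-+ʳ b n∣c+c′ ⟩
      b % n                      ∎
      where
      open ≡-Reasoning
      c′ : ℕ
      c′ = n ∸ c % n
      n∣c+c′ : n ∣ c + c′
      n∣c+c′ = divides (c / n + 1) (begin
        c + c′                          ≡⟨ cong (_+ c′) (m≡m%n+[m/n]*n c n) ⟩
        c % n + c / n * n + c′          ≡⟨ cong (_+ c′) (+-comm (c % n) (c / n * n)) ⟩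
        c / n * n + c % n + c′          ≡⟨ +-assoc (c / n * n) (c % n) c′ ⟩
        c / n * n + (c % n + c′)        ≡⟨ cong (c / n * n +_) (m+[n∸m]≡n (m%n≤n c n)) ⟩
        c / n * n + n                   ≡⟨ cong (c / n * n +_) (*-identityˡ n) ⟨
        c / n * n + 1 * n               ≡⟨ *-distribʳ-+ n (c / n) 1 ⟨
        (c / n + 1) * n                 ∎)

    %-+-cancelʳ-< : ∀ a b c → a < n → b < n → (a + c) % n ≡ (b + c) % n → a ≡ b
    %-+-cancelʳ-< a b c a<n b<n e =
      trans (sym (m<n⇒m%n≡m a<n)) (trans (%-+-cancelʳ a b c e) (m<n⇒m%n≡m b<n))

    [m+o]%n≡o%n⇒n∣m : ∀ m o → (m + o) % n ≡ o % n → n ∣ m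
    [m+o]%n≡o%n⇒n∣m m o e = m%n≡0⇒n∣m m n (trans (%-+-cancelʳ m 0 o e) (n∣m⇒m%n≡0 0 n (n ∣0)))

  ∣∧<⇒≡0 : ∀ {n d} → n ∣ d → d < n → d ≡ 0
  ∣∧<⇒≡0 {d = zero}  _   _   = refl
  ∣∧<⇒≡0 {d = suc d} n∣d d<n = ⊥-elim (<⇒≱ d<n (∣⇒≤ n∣d))

  ∣∧<2n⇒≡0⊎≡n : ∀ {n d} → n ∣ d → d < n + n → d ≡ 0 ⊎ d ≡ n
  ∣∧<2n⇒≡0⊎≡n {n} {d} n∣d d<2n with d <? n
  ... | yes d<n = inj₁ (∣∧<⇒≡0 n∣d d<n)
  ... | no d≮n = inj₂ (trans (sym (m∸n+n≡m n≤d)) (cong (_+ n) d∸n≡0))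
    where
    n≤d : n ≤ d
    n≤d = ≮⇒≥ d≮n
    d∸n<n : d ∸ n < n
    d∸n<n = +-cancelʳ-< _ _ _ (subst (_< n + n) (sym (m∸n+n≡m n≤d)) d<2n)
    d∸n≡0 : d ∸ n ≡ 0
    d∸n≡0 = ∣∧<⇒≡0 (∣m+n∣m⇒∣n (subst (n ∣_) (sym (m+[n∸m]≡n n≤d)) n∣d) ∣-refl) d∸n<n

  module _ {p : ℕ} .{{_ : NonZero p}} (p-prime : Prime p) where

    private
      cancel-≤ : ∀ a {u v} → ¬ p ∣ a → u ≤ v → v < p → (a * u) % p ≡ (a * v) % p → u ≡ v
      cancel-≤ a {u} p∤a u≤v v<p e with m≤n⇒∃[o]m+o≡n u≤v
      ... | d , refl = sym (trans (cong (u +_) d≡0) (+-identityʳ u))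
        where
        p∣ad : p ∣ a * d
        p∣ad = [m+o]%n≡o%n⇒n∣m p (a * d) (a * u)
          (trans (cong (_% p) (trans (+-comm (a * d) (a * u)) (sym (*-distribˡ-+ a u d)))) (sym e))
        d≡0 : d ≡ 0
        d≡0 with euclidsLemma a d p-prime p∣ad
        ... | inj₁ p∣a = ⊥-elim (p∤a p∣a)
        ... | inj₂ p∣d = ∣∧<⇒≡0 p∣d (≤-<-trans (m≤n+m d u) v<p)

    *-cancelˡ-%-prime : ∀ a y y′ → ¬ p ∣ a → y < p → y′ < p → (a * y) % p ≡ (a * y′) % p → y ≡ y′
    *-cancelˡ-%-prime a y y′ p∤a y<p y′<p e with ≤-total y y′
    ... | inj₁ y≤y′ = cancel-≤ a p∤a y≤y′ y′<p e
    ... | inj₂ y′≤y = sym (cancel-≤ a p∤a y′≤y y<p (sym e))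

module LegendreSymbol where

  open import Defs using (legendre)
  open FiniteSums
  open ModularArithmetic
  open import Data.Nat as ℕ using (ℕ; suc; _<_; _≤_; z≤n; s≤s; _∸_; NonZero; nonTrivial⇒n>1)
  open import Data.Nat.Properties
  open import Data.Nat.DivMod
  open import Data.Nat.Divisibility
  open import Data.Nat.Primality using (Prime; euclidsLemma; prime⇒irreducible; prime⇒nonTrivial)
  import Data.Nat.Tactic.RingSolver as ℕ-Solver
  open import Data.Integer as ℤ using (ℤ; +_; -[1+_]; _+_; _*_; -_; _-_)
  import Data.Integer.Properties as ℤ
  open import Data.Integer.Tactic.RingSolver using (solve-∀)
  open import Algebra.Properties.AbelianGroup ℤ.+-0-abelianGroup using (∙-cancelˡ)
  open import Data.Bool using (Bool; true; false; T; if_then_else_)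
  open import Data.Bool.ListAction using (any)
  open import Data.List using (upTo)
  open import Data.List.Relation.Unary.Any.Properties using (any⁺; any⁻)
  open import Data.List.Membership.Propositional using (lose; find)
  open import Data.List.Membership.Propositional.Properties using (∈-upTo⁺; ∈-upTo⁻)
  open import Data.Product using (_×_; _,_; proj₁; proj₂; ∃)
  open import Data.Sum using (_⊎_; inj₁; inj₂; [_,_]′)
  open import Data.Empty using (⊥-elim)
  open import Function using (_∘_)
  open import Relation.Nullary using (Dec; yes; no; does; ¬_)
  open import Relation.Nullary.Decidable using (dec-true)
  open import Relation.Binary.PropositionalEquality

  data Sign : ℤ → Set where
    plus  : Sign (+ 1)
    minus : Sign -[1+ 0 ]

  sign≢0 : ∀ {s} → Sign s → s ≢ + 0
  sign≢0 plus  ()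
  sign≢0 minus ()

  +1≢-1 : + 1 ≢ -[1+ 0 ]
  +1≢-1 ()

  sign² : ∀ {s} → Sign s → s * s ≡ + 1
  sign² plus  = refl
  sign² minus = refl

  -- legendre computes only once the modulus is a successor.
  legendre-unfold : ∀ p .{{_ : NonZero p}} a →
    legendre p a ≡ (if does (a % p ℕ.≟ 0) then + 0
                    else if any (λ x → does ((x ℕ.* x) % p ℕ.≟ a % p)) (upTo p) then + 1 else -[1+ 0 ])
  legendre-unfold (suc q) a = refl

  legendre-% : ∀ p .{{_ : NonZero p}} a → legendre p (a % p) ≡ legendre p a
  legendre-% p@(suc _) a with a % p % p | m%n%n≡m%n a p
  ... | _ | refl = refl

  4ij≡ : ∀ {i j} x y s t → + 2 * i ≡ x * x + s * x → + 2 * j ≡ y * y + t * y →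
         + 4 * (i * j) ≡ (x * x) * (y * y) + t * ((x * x) * y) + s * (x * (y * y)) + s * t * (x * y)
  4ij≡ {i} {j} x y s t 2i≡ 2j≡ = begin
    + 4 * (i * j)                     ≡⟨ split-4 i j ⟩
    (+ 2 * i) * (+ 2 * j)             ≡⟨ cong₂ _*_ 2i≡ 2j≡ ⟩
    (x * x + s * x) * (y * y + t * y) ≡⟨ multiply-out x y s t ⟩
    (x * x) * (y * y) + t * ((x * x) * y) + s * (x * (y * y)) + s * t * (x * y) ∎
    where
    open ≡-Reasoning
    split-4 : ∀ i j → + 4 * (i * j) ≡ (+ 2 * i) * (+ 2 * j)
    split-4 = solve-∀
    multiply-out : ∀ x y s t → (x * x + s * x) * (y * y + t * y)
                   ≡ (x * x) * (y * y) + t * ((x * x) * y) + s * (x * (y * y)) + s * t * (x * y)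
    multiply-out = solve-∀

  ≡4*⇒%4≡0 : ∀ a K → + a ≡ + 4 * K → a % 4 ≡ 0
  ≡4*⇒%4≡0 a (+ k) e = trans (cong (_% 4) (trans (ℤ.+-injective (trans e (sym (ℤ.pos-* 4 k)))) (*-comm 4 k))) (m*n%n≡0 k 4)

  [n%4]+s≡2 : ∀ {n s} K → Sign s → .{{_ : NonZero n}} → + n - s ≡ + 4 * K → + (n % 4) + s ≡ + 2
  [n%4]+s≡2 {suc m} K plus e = cong (λ r → + r + + 1) (begin
    suc m % 4            ≡⟨ [m+o%n]%n≡[m+o]%n 4 1 m ⟨
    (1 ℕ.+ m % 4) % 4    ≡⟨ cong (λ r → (1 ℕ.+ r) % 4) (≡4*⇒%4≡0 m K e) ⟩
    1                    ∎)
    where open ≡-Reasoning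
  [n%4]+s≡2 {suc m} K minus e = cong (λ r → + r + -[1+ 0 ])
    (%-pred-≡0 {suc m} {4} (trans (cong (_% 4) (+-comm 1 (suc m))) (≡4*⇒%4≡0 (suc m ℕ.+ 1) K e)))

  module AtOddPrime {p : ℕ} (p-prime : Prime p) (p≢2 : p ≢ 2) where

    1<p : 1 < p
    1<p = nonTrivial⇒n>1 p {{prime⇒nonTrivial p-prime}}

    instance
      p-nonZero : NonZero p
      p-nonZero = ℕ.>-nonZero (<-trans (s≤s z≤n) 1<p)

    χ : ℕ → ℤ
    χ = legendre p

    1%p≢0 : 1 % p ≢ 0
    1%p≢0 1%p≡0 with () ← trans (sym (m<n⇒m%n≡m 1<p)) 1%p≡0

    IsSquare : ℕ → Set
    IsSquare a = ∃ λ x → x < p × (x ℕ.* x) % p ≡ a % p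

    private
      is-root : ℕ → ℕ → Bool
      is-root a x = does ((x ℕ.* x) % p ℕ.≟ a % p)

      T-does : ∀ {a} {A : Set a} (d : Dec A) → T (does d) → A
      T-does (yes x) _ = x

      any-roots⇔IsSquare : ∀ a → (T (any (is-root a) (upTo p)) → IsSquare a) × (IsSquare a → T (any (is-root a) (upTo p)))
      any-roots⇔IsSquare a = from , to
        where
        from : T (any (is-root a) (upTo p)) → IsSquare a
        from t with x , x∈ , root ← find (any⁻ (is-root a) (upTo p) t) = x , ∈-upTo⁻ x∈ , T-does ((x ℕ.* x) % p ℕ.≟ a % p) root
        to : IsSquare a → T (any (is-root a) (upTo p))
        to (x , x<p , e) = any⁺ (is-root a) (lose (∈-upTo⁺ x<p) (subst T (sym (dec-true ((x ℕ.* x) % p ℕ.≟ a % p) e)) _))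

    data χ-View (a : ℕ) : Set where
      divisible  : a % p ≡ 0 → χ a ≡ + 0 → χ-View a
      residue    : a % p ≢ 0 → IsSquare a → χ a ≡ + 1 → χ-View a
      nonresidue : a % p ≢ 0 → ¬ IsSquare a → χ a ≡ -[1+ 0 ] → χ-View a

    χ-view : ∀ a → χ-View a
    χ-view a = by-cases (a % p ℕ.≟ 0) (any (is-root a) (upTo p)) refl (legendre-unfold p a)
      where
      by-cases : (d : Dec (a % p ≡ 0)) (b : Bool) → any (is-root a) (upTo p) ≡ b →
                 χ a ≡ (if does d then + 0 else if b then + 1 else -[1+ 0 ]) → χ-View a
      by-cases (yes a≡0) _     _       χa≡ = divisible a≡0 χa≡
      by-cases (no a≢0)  true  square? χa≡ = residue a≢0 (proj₁ (any-roots⇔IsSquare a) (subst T (sym square?) _)) χa≡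
      by-cases (no a≢0)  false square? χa≡ = nonresidue a≢0 (λ sq → subst T square? (proj₂ (any-roots⇔IsSquare a) sq)) χa≡

    χ-% : ∀ a → χ (a % p) ≡ χ a
    χ-% = legendre-% p

    χ≡0 : ∀ {a} → a % p ≡ 0 → χ a ≡ + 0
    χ≡0 {a} a≡0 with χ-view a
    ... | divisible _ e    = e
    ... | residue a≢0 _ _    = ⊥-elim (a≢0 a≡0)
    ... | nonresidue a≢0 _ _ = ⊥-elim (a≢0 a≡0)

    χ-sign : ∀ {a} → a % p ≢ 0 → Sign (χ a)
    χ-sign {a} a≢0 with χ-view a
    ... | divisible a≡0 _  = ⊥-elim (a≢0 a≡0)
    ... | residue _ _ e    = subst Sign (sym e) plus
    ... | nonresidue _ _ e = subst Sign (sym e) minus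

    χ² : ∀ {a} → a % p ≢ 0 → χ a * χ a ≡ + 1
    χ² a≢0 = sign² (χ-sign a≢0)

    χ²≡1-𝟙 : ∀ a → χ a * χ a ≡ + 1 - 𝟙 (a % p ℕ.≟ 0)
    χ²≡1-𝟙 a = by-cases (a % p ℕ.≟ 0)
      where
      by-cases : (d : Dec (a % p ≡ 0)) → χ a * χ a ≡ + 1 - 𝟙 d
      by-cases (yes a≡0) = cong (λ z → z * z) (χ≡0 a≡0)
      by-cases (no a≢0)  = χ² a≢0

    χ1≡+1 : χ 1 ≡ + 1
    χ1≡+1 with χ-view 1
    ... | divisible 1≡0 _    = ⊥-elim (1%p≢0 1≡0)
    ... | residue _ _ e      = e
    ... | nonresidue _ ¬sq _ = ⊥-elim (¬sq (1 , 1<p , refl))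

    x²≡0⇒x≡0 : ∀ {x} → x < p → (x ℕ.* x) % p ≡ 0 → x ≡ 0
    x²≡0⇒x≡0 {x} x<p e with euclidsLemma x x p-prime (m%n≡0⇒n∣m (x ℕ.* x) p e)
    ... | inj₁ p∣x = ∣∧<⇒≡0 p∣x x<p
    ... | inj₂ p∣x = ∣∧<⇒≡0 p∣x x<p

    [p∸x]²≡x² : ∀ {x} → x ≤ p → ((p ∸ x) ℕ.* (p ∸ x)) % p ≡ (x ℕ.* x) % p
    [p∸x]²≡x² {x} x≤p = begin
      (y ℕ.* y) % p                                   ≡⟨ [m+kn]%n≡m%n (y ℕ.* y) (2 ℕ.* x) p ⟨
      (y ℕ.* y ℕ.+ 2 ℕ.* x ℕ.* p) % p                 ≡⟨ cong (λ z → (y ℕ.* y ℕ.+ 2 ℕ.* x ℕ.* z) % p) y+x≡p ⟨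
      (y ℕ.* y ℕ.+ 2 ℕ.* x ℕ.* (y ℕ.+ x)) % p         ≡⟨ cong (_% p) (expand y x) ⟩
      (x ℕ.* x ℕ.+ (y ℕ.+ x) ℕ.* (y ℕ.+ x)) % p       ≡⟨ cong (λ z → (x ℕ.* x ℕ.+ z ℕ.* z) % p) y+x≡p ⟩
      (x ℕ.* x ℕ.+ p ℕ.* p) % p                       ≡⟨ [m+kn]%n≡m%n (x ℕ.* x) p p ⟩
      (x ℕ.* x) % p                                   ∎
      where
      open ≡-Reasoning
      y : ℕ
      y = p ∸ x
      y+x≡p : y ℕ.+ x ≡ p
      y+x≡p = m∸n+n≡m x≤p
      expand : ∀ y x → y ℕ.* y ℕ.+ 2 ℕ.* x ℕ.* (y ℕ.+ x) ≡ x ℕ.* x ℕ.+ (y ℕ.+ x) ℕ.* (y ℕ.+ x)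
      expand = ℕ-Solver.solve-∀

    x+x≢p : ∀ x → x ℕ.+ x ≢ p
    x+x≢p x x+x≡p with prime⇒irreducible p-prime 2∣p
      where
      2∣p : 2 ∣ p
      2∣p = divides x (trans (sym x+x≡p) (trans (cong (x ℕ.+_) (sym (+-identityʳ x))) (*-comm 2 x)))
    ... | inj₁ ()
    ... | inj₂ 2≡p = p≢2 (sym 2≡p)

    -- Both factors of (x + x₀)(x + (p ∸ x₀)) ≡ x² − x₀² (mod p) are below 2p.
    square-roots : ∀ {x x₀} → x < p → x₀ < p → x₀ ≢ 0 → (x ℕ.* x) % p ≡ (x₀ ℕ.* x₀) % p →
                   x ≡ x₀ ⊎ x ≡ p ∸ x₀
    square-roots {x} {x₀} x<p x₀<p x₀≢0 e with euclidsLemma (x ℕ.+ x₀) (x ℕ.+ (p ∸ x₀)) p-prime p∣product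
      where
      y+x₀≡p : (p ∸ x₀) ℕ.+ x₀ ≡ p
      y+x₀≡p = m∸n+n≡m (<⇒≤ x₀<p)
      expand : ∀ x x₀ y → (x ℕ.+ x₀) ℕ.* (x ℕ.+ y) ℕ.+ x₀ ℕ.* x₀ ≡ x ℕ.* x ℕ.+ (x ℕ.+ x₀) ℕ.* (y ℕ.+ x₀)
      expand = ℕ-Solver.solve-∀
      p∣product : p ∣ (x ℕ.+ x₀) ℕ.* (x ℕ.+ (p ∸ x₀))
      p∣product = [m+o]%n≡o%n⇒n∣m p _ (x₀ ℕ.* x₀) (begin
        ((x ℕ.+ x₀) ℕ.* (x ℕ.+ (p ∸ x₀)) ℕ.+ x₀ ℕ.* x₀) % p
          ≡⟨ cong (_% p) (expand x x₀ (p ∸ x₀)) ⟩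
        (x ℕ.* x ℕ.+ (x ℕ.+ x₀) ℕ.* ((p ∸ x₀) ℕ.+ x₀)) % p
          ≡⟨ cong (λ z → (x ℕ.* x ℕ.+ (x ℕ.+ x₀) ℕ.* z) % p) y+x₀≡p ⟩
        (x ℕ.* x ℕ.+ (x ℕ.+ x₀) ℕ.* p) % p
          ≡⟨ [m+kn]%n≡m%n (x ℕ.* x) (x ℕ.+ x₀) p ⟩
        (x ℕ.* x) % p
          ≡⟨ e ⟩
        (x₀ ℕ.* x₀) % p
          ∎)
        where open ≡-Reasoning
    ... | inj₁ p∣x+x₀ with ∣∧<2n⇒≡0⊎≡n p∣x+x₀ (+-mono-< x<p x₀<p)
    ...   | inj₁ x+x₀≡0 = ⊥-elim (x₀≢0 (m+n≡0⇒n≡0 x x+x₀≡0))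
    ...   | inj₂ x+x₀≡p = inj₂ (trans (sym (m+n∸n≡m x x₀)) (cong (_∸ x₀) x+x₀≡p))
    square-roots {x} {x₀} x<p x₀<p x₀≢0 e | inj₂ p∣x+y
      with ∣∧<2n⇒≡0⊎≡n p∣x+y (+-mono-<-≤ x<p (m∸n≤m p x₀))
    ...   | inj₁ x+y≡0 = ⊥-elim (<⇒≢ x₀<p (sym (trans (sym (m∸n+n≡m (<⇒≤ x₀<p)))
                                                     (cong (ℕ._+ x₀) (m+n≡0⇒n≡0 x x+y≡0)))))
    ...   | inj₂ x+y≡p = inj₁ (+-cancelʳ-≡ (p ∸ x₀) x x₀
                            (trans x+y≡p (sym (trans (+-comm x₀ (p ∸ x₀)) (m∸n+n≡m (<⇒≤ x₀<p))))))

    0<p : 0 < p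
    0<p = ℕ.>-nonZero⁻¹ p

    0%p≡0 : 0 % p ≡ 0
    0%p≡0 = m<n⇒m%n≡m 0<p

    𝟙[x²≡x₀²] : ∀ {x x₀} → x < p → x₀ < p → x₀ ≢ 0 →
                𝟙 ((x ℕ.* x) % p ℕ.≟ (x₀ ℕ.* x₀) % p) ≡ 𝟙 (x ℕ.≟ x₀) + 𝟙 (x ℕ.≟ p ∸ x₀)
    𝟙[x²≡x₀²] {x} {x₀} x<p x₀<p x₀≢0 = by-cases (x ℕ.≟ x₀) (x ℕ.≟ p ∸ x₀)
      where
      x²≡x₀²? : Dec ((x ℕ.* x) % p ≡ (x₀ ℕ.* x₀) % p)
      x²≡x₀²? = (x ℕ.* x) % p ℕ.≟ (x₀ ℕ.* x₀) % p
      by-cases : (d : Dec (x ≡ x₀)) (d′ : Dec (x ≡ p ∸ x₀)) → 𝟙 x²≡x₀²? ≡ 𝟙 d + 𝟙 d′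
      by-cases (yes x≡x₀) (yes x≡p∸x₀) =
        ⊥-elim (x+x≢p x₀ (trans (cong (x₀ ℕ.+_) (trans (sym x≡x₀) x≡p∸x₀)) (m+[n∸m]≡n (<⇒≤ x₀<p))))
      by-cases (yes x≡x₀) (no _) =
        𝟙-yes x²≡x₀²? (cong (λ z → (z ℕ.* z) % p) x≡x₀)
      by-cases (no _) (yes x≡p∸x₀) =
        𝟙-yes x²≡x₀²? (trans (cong (λ z → (z ℕ.* z) % p) x≡p∸x₀) ([p∸x]²≡x² (<⇒≤ x₀<p)))
      by-cases (no x≢x₀) (no x≢p∸x₀) =
        𝟙-no x²≡x₀²? (λ e → [ x≢x₀ , x≢p∸x₀ ]′ (square-roots x<p x₀<p x₀≢0 e))

    #square-roots : ∀ {y} → y < p → ∑[ x < p ] 𝟙 ((x ℕ.* x) % p ℕ.≟ y) ≡ + 1 + χ y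
    #square-roots {y} y<p with χ-view y
    ... | divisible y%p≡0 χy≡0 = begin
      ∑[ x < p ] 𝟙 ((x ℕ.* x) % p ℕ.≟ y)  ≡⟨ ∑-cong p (λ x x<p → 𝟙-cong ((x ℕ.* x) % p ℕ.≟ y) (x ℕ.≟ 0)
                                                (λ e → x²≡0⇒x≡0 x<p (trans e y≡0))
                                                (λ x≡0 → trans (cong (λ z → (z ℕ.* z) % p) x≡0) (trans 0%p≡0 (sym y≡0)))) ⟩
      ∑[ x < p ] 𝟙 (x ℕ.≟ 0)             ≡⟨ ∑-𝟙-≟ p 0 0<p ⟩
      + 1 + + 0                           ≡⟨ cong (_+_ (+ 1)) χy≡0 ⟨
      + 1 + χ y                           ∎
      where
      open ≡-Reasoning
      y≡0 : y ≡ 0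
      y≡0 = trans (sym (m<n⇒m%n≡m y<p)) y%p≡0
    ... | residue _ (x₀ , x₀<p , x₀²≡y) χy≡1 = begin
      ∑[ x < p ] 𝟙 ((x ℕ.* x) % p ℕ.≟ y)
        ≡⟨ ∑-cong p (λ x x<p → trans (𝟙-cong ((x ℕ.* x) % p ℕ.≟ y) ((x ℕ.* x) % p ℕ.≟ (x₀ ℕ.* x₀) % p)
                                              (λ e → trans e (sym x₀²≡y′)) (λ e → trans e x₀²≡y′))
                                     (𝟙[x²≡x₀²] x<p x₀<p x₀≢0)) ⟩
      ∑[ x < p ] 𝟙 (x ℕ.≟ x₀) + 𝟙 (x ℕ.≟ p ∸ x₀)
        ≡⟨ ∑-distrib-+ p _ _ ⟩
      ∑< p (λ x → 𝟙 (x ℕ.≟ x₀)) + ∑< p (λ x → 𝟙 (x ℕ.≟ p ∸ x₀))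
        ≡⟨ cong₂ _+_ (∑-𝟙-≟ p x₀ x₀<p) (∑-𝟙-≟ p (p ∸ x₀) p∸x₀<p) ⟩
      + 1 + + 1
        ≡⟨ cong (_+_ (+ 1)) χy≡1 ⟨
      + 1 + χ y
        ∎
      where
      open ≡-Reasoning
      x₀²≡y′ : (x₀ ℕ.* x₀) % p ≡ y
      x₀²≡y′ = trans x₀²≡y (m<n⇒m%n≡m y<p)
      x₀≢0 : x₀ ≢ 0
      x₀≢0 x₀≡0 = sign≢0 plus (trans (sym χy≡1)
                    (χ≡0 (trans (sym x₀²≡y) (trans (cong (λ z → (z ℕ.* z) % p) x₀≡0) 0%p≡0))))
      p∸x₀<p : p ∸ x₀ < p
      p∸x₀<p = ∸-monoʳ-< {o = 0} (n≢0⇒n>0 x₀≢0) (<⇒≤ x₀<p)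
    ... | nonresidue _ ¬square χy≡-1 = begin
      ∑[ x < p ] 𝟙 ((x ℕ.* x) % p ℕ.≟ y)  ≡⟨ ∑-vanishing p (λ x x<p → 𝟙-no ((x ℕ.* x) % p ℕ.≟ y) (λ e →
                                               ¬square (x , x<p , trans e (sym (m<n⇒m%n≡m y<p))))) ⟩
      + 1 + -[1+ 0 ]                      ≡⟨ cong (_+_ (+ 1)) χy≡-1 ⟨
      + 1 + χ y                           ∎
      where open ≡-Reasoning

    ∑χ≡0 : ∑[ y < p ] χ y ≡ + 0
    ∑χ≡0 = ∙-cancelˡ (+ p) (∑< p χ) (+ 0) (begin
      + p + ∑< p χ                                     ≡⟨ cong (_+ ∑< p χ) (∑-one p) ⟨
      ∑< p (λ _ → + 1) + ∑< p χ                        ≡⟨ ∑-distrib-+ p (λ _ → + 1) χ ⟨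
      ∑[ y < p ] + 1 + χ y                             ≡⟨ ∑-cong p (λ y y<p → #square-roots y<p) ⟨
      ∑[ y < p ] ∑[ x < p ] 𝟙 ((x ℕ.* x) % p ℕ.≟ y)    ≡⟨ ∑-comm p p (λ y x → 𝟙 ((x ℕ.* x) % p ℕ.≟ y)) ⟩
      ∑[ x < p ] ∑[ y < p ] 𝟙 ((x ℕ.* x) % p ℕ.≟ y)    ≡⟨ ∑-cong p (λ x _ → one-value x) ⟩
      ∑[ x < p ] + 1                                   ≡⟨ ∑-one p ⟩
      + p                                              ≡⟨ ℤ.+-identityʳ (+ p) ⟨
      + p + + 0                                        ∎)
      where
      open ≡-Reasoning
      one-value : ∀ x → ∑[ y < p ] 𝟙 ((x ℕ.* x) % p ℕ.≟ y) ≡ + 1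
      one-value x = trans (∑-cong p (λ y _ → 𝟙-cong ((x ℕ.* x) % p ℕ.≟ y) (y ℕ.≟ (x ℕ.* x) % p) sym sym))
                          (∑-𝟙-≟ p ((x ℕ.* x) % p) (m%n<n (x ℕ.* x) p))

    χ≡+1⇒residue : ∀ {a} → χ a ≡ + 1 → a % p ≢ 0 × IsSquare a
    χ≡+1⇒residue {a} χa≡1 with χ-view a
    ... | divisible _ χa≡0     = ⊥-elim (sign≢0 plus (trans (sym χa≡1) χa≡0))
    ... | residue a≢0 sq _     = a≢0 , sq
    ... | nonresidue _ _ χa≡-1 = ⊥-elim (+1≢-1 (trans (sym χa≡1) χa≡-1))

    residue⇒χ≡+1 : ∀ {a} → a % p ≢ 0 → IsSquare a → χ a ≡ + 1
    residue⇒χ≡+1 {a} a≢0 sq with χ-view a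
    ... | divisible a≡0 _    = ⊥-elim (a≢0 a≡0)
    ... | residue _ _ e      = e
    ... | nonresidue _ ¬sq _ = ⊥-elim (¬sq sq)

    %p≢0-* : ∀ {a b} → a % p ≢ 0 → b % p ≢ 0 → (a ℕ.* b) % p ≢ 0
    %p≢0-* {a} {b} a≢0 b≢0 ab≡0 with euclidsLemma a b p-prime (m%n≡0⇒n∣m (a ℕ.* b) p ab≡0)
    ... | inj₁ p∣a = a≢0 (n∣m⇒m%n≡0 a p p∣a)
    ... | inj₂ p∣b = b≢0 (n∣m⇒m%n≡0 b p p∣b)

    %p≡0-*ʳ : ∀ a {b} → b % p ≡ 0 → (a ℕ.* b) % p ≡ 0
    %p≡0-*ʳ a {b} b≡0 = begin
      (a ℕ.* b) % p          ≡⟨ [m*o%n]%n≡[m*o]%n p a b ⟨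
      (a ℕ.* (b % p)) % p    ≡⟨ cong (λ z → (a ℕ.* z) % p) b≡0 ⟩
      (a ℕ.* 0) % p          ≡⟨ cong (_% p) (*-zeroʳ a) ⟩
      0 % p                  ≡⟨ 0%p≡0 ⟩
      0                      ∎
      where open ≡-Reasoning

    IsSquare-* : ∀ {a b} → IsSquare a → IsSquare b → IsSquare (a ℕ.* b)
    IsSquare-* {a} {b} (x , _ , x²≡a) (y , _ , y²≡b) = (x ℕ.* y) % p , m%n<n (x ℕ.* y) p , (begin
      ((x ℕ.* y) % p ℕ.* ((x ℕ.* y) % p)) % p  ≡⟨ %-distribˡ-* (x ℕ.* y) (x ℕ.* y) p ⟨
      ((x ℕ.* y) ℕ.* (x ℕ.* y)) % p            ≡⟨ cong (_% p) (regroup x y) ⟩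
      ((x ℕ.* x) ℕ.* (y ℕ.* y)) % p            ≡⟨ %-distribˡ-* (x ℕ.* x) (y ℕ.* y) p ⟩
      ((x ℕ.* x) % p ℕ.* ((y ℕ.* y) % p)) % p  ≡⟨ cong₂ (λ u v → (u ℕ.* v) % p) x²≡a y²≡b ⟩
      (a % p ℕ.* (b % p)) % p                  ≡⟨ %-distribˡ-* a b p ⟨
      (a ℕ.* b) % p                            ∎)
      where
      open ≡-Reasoning
      regroup : ∀ x y → (x ℕ.* y) ℕ.* (x ℕ.* y) ≡ (x ℕ.* x) ℕ.* (y ℕ.* y)
      regroup = ℕ-Solver.solve-∀

    χ-*-% : ∀ a b → χ (a ℕ.* (b % p)) ≡ χ (a ℕ.* b)
    χ-*-% a b = trans (sym (χ-% (a ℕ.* (b % p)))) (trans (cong χ ([m*o%n]%n≡[m*o]%n p a b)) (χ-% (a ℕ.* b)))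

    ∑χ[a*y]≡0 : ∀ {a} → a % p ≢ 0 → ∑[ y < p ] χ (a ℕ.* y) ≡ + 0
    ∑χ[a*y]≡0 {a} a≢0 =
      trans (∑-cong p (λ y _ → sym (χ-% (a ℕ.* y))))
            (trans (∑-reindex p (λ y → (a ℕ.* y) % p) (λ y _ → m%n<n (a ℕ.* y) p)
                     (λ y y′ y<p y′<p → *-cancelˡ-%-prime p-prime a y y′ (a≢0 ∘ n∣m⇒m%n≡0 a p) y<p y′<p) χ)
                   ∑χ≡0)

    flip-defect : ℕ → ℤ → ℕ → ℤ
    flip-defect a c y = c * χ (a ℕ.* y) + -[1+ 0 ] * χ y

    flip-defect≥0 : ∀ {a c} → a % p ≢ 0 → Sign c → (∀ y → y < p → χ y ≡ + 1 → χ (a ℕ.* y) ≡ c) →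
                    ∀ {y} → y < p → + 0 ℤ.≤ flip-defect a c y
    flip-defect≥0 {a} {c} a≢0 sign-c on-residues {y} y<p with χ-view y
    ... | divisible y≡0 χy≡0 = ℤ.≤-reflexive (sym (begin
      c * χ (a ℕ.* y) + -[1+ 0 ] * χ y  ≡⟨ cong₂ (λ u v → c * u + -[1+ 0 ] * v) (χ≡0 (%p≡0-*ʳ a y≡0)) χy≡0 ⟩
      c * + 0 + -[1+ 0 ] * + 0           ≡⟨ cong (_+ + 0) (ℤ.*-zeroʳ c) ⟩
      + 0                                ∎))
      where open ≡-Reasoning
    ... | residue _ _ χy≡1 = ℤ.≤-reflexive (sym (trans
      (cong₂ (λ u v → c * u + -[1+ 0 ] * v) (on-residues y y<p χy≡1) χy≡1)
      (cong (_+ -[1+ 0 ]) (sign² sign-c))))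
    ... | nonresidue y≢0 _ χy≡-1 = subst (+ 0 ℤ.≤_)
      (cong (λ v → c * χ (a ℕ.* y) + -[1+ 0 ] * v) (sym χy≡-1))
      (nonneg sign-c (χ-sign (%p≢0-* a≢0 y≢0)))
      where
      nonneg : ∀ {s t} → Sign s → Sign t → + 0 ℤ.≤ s * t + + 1
      nonneg plus  plus  = ℤ.+≤+ z≤n
      nonneg plus  minus = ℤ.+≤+ z≤n
      nonneg minus plus  = ℤ.+≤+ z≤n
      nonneg minus minus = ℤ.+≤+ z≤n

    ∑flip-defect≡0 : ∀ {a} c → a % p ≢ 0 → ∑< p (flip-defect a c) ≡ + 0
    ∑flip-defect≡0 {a} c a≢0 = begin
      ∑< p (flip-defect a c)
        ≡⟨ ∑-linear p (λ y → c * χ (a ℕ.* y)) -[1+ 0 ] χ ⟩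
      ∑< p (λ y → c * χ (a ℕ.* y)) + -[1+ 0 ] * ∑< p χ
        ≡⟨ cong (_+ -[1+ 0 ] * ∑< p χ) (∑-*ˡ p c (λ y → χ (a ℕ.* y))) ⟩
      c * ∑< p (λ y → χ (a ℕ.* y)) + -[1+ 0 ] * ∑< p χ
        ≡⟨ cong₂ (λ u v → c * u + -[1+ 0 ] * v) (∑χ[a*y]≡0 a≢0) ∑χ≡0 ⟩
      c * + 0 + -[1+ 0 ] * + 0
        ≡⟨ cong (_+ + 0) (ℤ.*-zeroʳ c) ⟩
      + 0
        ∎
      where open ≡-Reasoning

    -- The defects c χ(a y) − χ(y) are all ≥ 0 and sum to 0, so they vanish.
    χ-flip : ∀ {a c} → a % p ≢ 0 → Sign c → (∀ y → y < p → χ y ≡ + 1 → χ (a ℕ.* y) ≡ c) →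
             ∀ b → χ b ≡ -[1+ 0 ] → χ (a ℕ.* b) ≡ - c
    χ-flip {a} {c} a≢0 sign-c on-residues b χb≡-1 =
      trans (sym (χ-*-% a b)) (solve-for-χ (χ-sign (%p≢0-* a≢0 b′≢0)) sign-c defect≡0)
      where
      b′ : ℕ
      b′ = b % p
      χb′≡-1 : χ b′ ≡ -[1+ 0 ]
      χb′≡-1 = trans (χ-% b) χb≡-1
      b′≢0 : b′ % p ≢ 0
      b′≢0 b′≡0 = sign≢0 minus (trans (sym χb′≡-1) (χ≡0 b′≡0))
      defect≡0 : c * χ (a ℕ.* b′) + + 1 ≡ + 0
      defect≡0 = trans (cong (λ v → c * χ (a ℕ.* b′) + -[1+ 0 ] * v) (sym χb′≡-1))
        (∑-nonneg-≡0 p (flip-defect a c) (λ y → flip-defect≥0 a≢0 sign-c on-residues)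
                     (∑flip-defect≡0 c a≢0) b′ (m%n<n b p))
      solve-for-χ : ∀ {s c} → Sign s → Sign c → c * s + + 1 ≡ + 0 → s ≡ - c
      solve-for-χ plus  minus _ = refl
      solve-for-χ minus plus  _ = refl
      solve-for-χ plus  plus  ()
      solve-for-χ minus minus ()

    χ-*-residue : ∀ {a} → a % p ≢ 0 → IsSquare a → ∀ b → χ (a ℕ.* b) ≡ χ b
    χ-*-residue {a} a≢0 sq b with χ-view b
    ... | divisible b≡0 χb≡0 = trans (χ≡0 (%p≡0-*ʳ a b≡0)) (sym χb≡0)
    ... | residue b≢0 sq′ χb≡1 = trans (residue⇒χ≡+1 (%p≢0-* a≢0 b≢0) (IsSquare-* sq sq′)) (sym χb≡1)
    ... | nonresidue _ _ χb≡-1 = trans (χ-flip a≢0 plus on-residues b χb≡-1) (sym χb≡-1)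
      where
      on-residues : ∀ y → y < p → χ y ≡ + 1 → χ (a ℕ.* y) ≡ + 1
      on-residues y _ χy≡1 = let y≢0 , sq′ = χ≡+1⇒residue χy≡1 in
        residue⇒χ≡+1 (%p≢0-* a≢0 y≢0) (IsSquare-* sq sq′)

    χ-*-nonresidue : ∀ {a} → χ a ≡ -[1+ 0 ] → ∀ b → χ (a ℕ.* b) ≡ - χ b
    χ-*-nonresidue {a} χa≡-1 b with χ-view a | χ-view b
    ... | divisible _ χa≡0 | _ = ⊥-elim (sign≢0 minus (trans (sym χa≡-1) χa≡0))
    ... | residue _ _ χa≡1 | _ = ⊥-elim (+1≢-1 (trans (sym χa≡1) χa≡-1))
    ... | nonresidue a≢0 _ _ | divisible b≡0 χb≡0 = trans (χ≡0 (%p≡0-*ʳ a b≡0)) (cong -_ (sym χb≡0))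
    ... | nonresidue a≢0 _ _ | residue b≢0 sq χb≡1 =
      trans (cong χ (*-comm a b)) (trans (χ-*-residue b≢0 sq a) (trans χa≡-1 (cong -_ (sym χb≡1))))
    ... | nonresidue a≢0 _ _ | nonresidue _ _ χb≡-1 =
      trans (χ-flip a≢0 minus on-residues b χb≡-1) (cong -_ (sym χb≡-1))
      where
      on-residues : ∀ y → y < p → χ y ≡ + 1 → χ (a ℕ.* y) ≡ -[1+ 0 ]
      on-residues y _ χy≡1 = let y≢0 , sq = χ≡+1⇒residue χy≡1 in
        trans (cong χ (*-comm a y)) (trans (χ-*-residue y≢0 sq a) χa≡-1)

    χ-* : ∀ a b → χ (a ℕ.* b) ≡ χ a * χ b
    χ-* a b with χ-view a
    ... | divisible a≡0 χa≡0 = trans (χ≡0 (trans (cong (_% p) (*-comm a b)) (%p≡0-*ʳ b a≡0)))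
                                     (sym (trans (cong (_* χ b) χa≡0) (ℤ.*-zeroˡ (χ b))))
    ... | residue a≢0 sq χa≡1 = trans (χ-*-residue a≢0 sq b) (sym (trans (cong (_* χ b) χa≡1) (ℤ.*-identityˡ (χ b))))
    ... | nonresidue _ _ χa≡-1 = trans (χ-*-nonresidue χa≡-1 b) (sym (trans (cong (_* χ b) χa≡-1) (ℤ.-1*i≡-i (χ b))))

    infixl 6 _-ₚ_
    _-ₚ_ : ℕ → ℕ → ℕ
    w -ₚ r = (w ℕ.+ (p ∸ r)) % p

    -ₚ<p : ∀ w r → w -ₚ r < p
    -ₚ<p w r = m%n<n (w ℕ.+ (p ∸ r)) p

    [w-ₚr+r]%p≡w%p : ∀ w {r} → r ≤ p → (w -ₚ r ℕ.+ r) % p ≡ w % p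
    [w-ₚr+r]%p≡w%p w {r} r≤p = begin
      ((w ℕ.+ (p ∸ r)) % p ℕ.+ r) % p  ≡⟨ [m%n+o]%n≡[m+o]%n p (w ℕ.+ (p ∸ r)) r ⟩
      (w ℕ.+ (p ∸ r) ℕ.+ r) % p        ≡⟨ cong (_% p) (+-assoc w (p ∸ r) r) ⟩
      (w ℕ.+ ((p ∸ r) ℕ.+ r)) % p      ≡⟨ cong (λ z → (w ℕ.+ z) % p) (m∸n+n≡m r≤p) ⟩
      (w ℕ.+ p) % p                    ≡⟨ [m+n]%n≡m%n w p ⟩
      w % p                            ∎
      where open ≡-Reasoning

    -ₚ-injectiveʳ : ∀ w {r r′} → r < p → r′ < p → w -ₚ r ≡ w -ₚ r′ → r ≡ r′
    -ₚ-injectiveʳ w {r} {r′} r<p r′<p e = %-+-cancelʳ-< p r r′ (w -ₚ r) r<p r′<p (begin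
      (r ℕ.+ (w -ₚ r)) % p    ≡⟨ cong (_% p) (+-comm r (w -ₚ r)) ⟩
      (w -ₚ r ℕ.+ r) % p      ≡⟨ [w-ₚr+r]%p≡w%p w (<⇒≤ r<p) ⟩
      w % p                   ≡⟨ [w-ₚr+r]%p≡w%p w (<⇒≤ r′<p) ⟨
      (w -ₚ r′ ℕ.+ r′) % p    ≡⟨ cong (λ z → (z ℕ.+ r′) % p) e ⟨
      (w -ₚ r ℕ.+ r′) % p     ≡⟨ cong (_% p) (+-comm (w -ₚ r) r′) ⟩
      (r′ ℕ.+ (w -ₚ r)) % p   ∎)
      where open ≡-Reasoning

    -ₚ-injectiveˡ : ∀ r {w w′} → w < p → w′ < p → w -ₚ r ≡ w′ -ₚ r → w ≡ w′
    -ₚ-injectiveˡ r {w} {w′} w<p w′<p e = %-+-cancelʳ-< p w w′ (p ∸ r) w<p w′<p e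

    [w-ₚr]%p≡0⇔r≡w%p : ∀ w {r} → r < p → ((w -ₚ r) % p ≡ 0 → r ≡ w % p) × (r ≡ w % p → (w -ₚ r) % p ≡ 0)
    [w-ₚr]%p≡0⇔r≡w%p w {r} r<p = to , from
      where
      [w-ₚr]%p≡w-ₚr : (w -ₚ r) % p ≡ w -ₚ r
      [w-ₚr]%p≡w-ₚr = m%n%n≡m%n (w ℕ.+ (p ∸ r)) p
      to : (w -ₚ r) % p ≡ 0 → r ≡ w % p
      to e = trans (sym (m<n⇒m%n≡m r<p))
               (trans (cong (λ z → (z ℕ.+ r) % p) (trans (sym e) [w-ₚr]%p≡w-ₚr)) ([w-ₚr+r]%p≡w%p w (<⇒≤ r<p)))
      from : r ≡ w % p → (w -ₚ r) % p ≡ 0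
      from r≡w = trans [w-ₚr]%p≡w-ₚr (%-+-cancelʳ-< p (w -ₚ r) 0 r (-ₚ<p w r) 0<p
        (trans ([w-ₚr+r]%p≡w%p w (<⇒≤ r<p)) (trans (sym (m%n%n≡m%n w p)) (cong (_% p) (sym r≡w)))))

    χr²≡1-𝟙 : ∀ {r} → r < p → χ r * χ r ≡ + 1 - 𝟙 (r ℕ.≟ 0)
    χr²≡1-𝟙 {r} r<p = trans (χ²≡1-𝟙 r) (cong (λ d → + 1 - d)
      (𝟙-cong (r % p ℕ.≟ 0) (r ℕ.≟ 0) (trans (sym r%p≡r)) (trans r%p≡r)))
      where
      r%p≡r : r % p ≡ r
      r%p≡r = m<n⇒m%n≡m r<p

    χ[w-ₚr]²≡1-𝟙 : ∀ w {r} → r < p → χ (w -ₚ r) * χ (w -ₚ r) ≡ + 1 - 𝟙 (r ℕ.≟ w % p)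
    χ[w-ₚr]²≡1-𝟙 w {r} r<p = trans (χ²≡1-𝟙 (w -ₚ r)) (cong (λ d → + 1 - d)
      (𝟙-cong ((w -ₚ r) % p ℕ.≟ 0) (r ℕ.≟ w % p) (proj₁ ([w-ₚr]%p≡0⇔r≡w%p w r<p)) (proj₂ ([w-ₚr]%p≡0⇔r≡w%p w r<p))))

    χ[w-ₚ0]≡χw : ∀ w → χ (w -ₚ 0) ≡ χ w
    χ[w-ₚ0]≡χw w = trans (χ-% (w ℕ.+ p)) (trans (sym (χ-% (w ℕ.+ p))) (trans (cong χ ([m+n]%n≡m%n w p)) (χ-% w)))

    ∑χ[w-ₚr]≡0 : ∀ w → ∑[ r < p ] χ (w -ₚ r) ≡ + 0
    ∑χ[w-ₚr]≡0 w = trans (∑-reindex p (w -ₚ_) (λ r _ → -ₚ<p w r) (λ r r′ r<p r′<p → -ₚ-injectiveʳ w r<p r′<p) χ) ∑χ≡0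

    jacobi : ℕ → ℤ
    jacobi w = ∑[ r < p ] χ r * χ (w -ₚ r)

    ∑jacobi≡0 : ∑[ w < p ] jacobi w ≡ + 0
    ∑jacobi≡0 = begin
      ∑[ w < p ] ∑[ r < p ] χ r * χ (w -ₚ r)    ≡⟨ ∑-comm p p (λ w r → χ r * χ (w -ₚ r)) ⟩
      ∑[ r < p ] ∑[ w < p ] χ r * χ (w -ₚ r)    ≡⟨ ∑-vanishing p (λ r r<p → trans (∑-*ˡ p (χ r) _)
                                                    (trans (cong (χ r *_) (shifted-sum r<p)) (ℤ.*-zeroʳ (χ r)))) ⟩
      + 0                                      ∎
      where
      open ≡-Reasoning
      shifted-sum : ∀ {r} → r < p → ∑[ w < p ] χ (w -ₚ r) ≡ + 0
      shifted-sum {r} r<p = trans (∑-reindex p (_-ₚ r) (λ w _ → -ₚ<p w r) (λ w w′ → -ₚ-injectiveˡ r) χ) ∑χ≡0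

    -ₚ-*ˡ : ∀ w {y} → y < p → (w -ₚ (w ℕ.* y) % p) % p ≡ (w ℕ.* (1 -ₚ y)) % p
    -ₚ-*ˡ w {y} y<p = begin
      (w -ₚ A) % p            ≡⟨ m%n%n≡m%n X p ⟩
      X % p                   ≡⟨ %-+-cancelʳ p X Y A (trans X+A≡w (sym Y+A≡w)) ⟩
      Y % p                   ≡⟨ [m*o%n]%n≡[m*o]%n p w (1 ℕ.+ (p ∸ y)) ⟨
      (w ℕ.* (1 -ₚ y)) % p    ∎
      where
      open ≡-Reasoning
      A X Y : ℕ
      A = (w ℕ.* y) % p
      X = w ℕ.+ (p ∸ A)
      Y = w ℕ.* (1 ℕ.+ (p ∸ y))
      X+A≡w : (X ℕ.+ A) % p ≡ w % p
      X+A≡w = trans (cong (_% p) (+-assoc w (p ∸ A) A))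
                    (trans (cong (λ z → (w ℕ.+ z) % p) (m∸n+n≡m (<⇒≤ (m%n<n (w ℕ.* y) p)))) ([m+n]%n≡m%n w p))
      regroup : ∀ w y z → w ℕ.* (1 ℕ.+ z) ℕ.+ w ℕ.* y ≡ w ℕ.+ w ℕ.* (z ℕ.+ y)
      regroup = ℕ-Solver.solve-∀
      Y+A≡w : (Y ℕ.+ A) % p ≡ w % p
      Y+A≡w = begin
        (Y ℕ.+ A) % p                       ≡⟨ [m+o%n]%n≡[m+o]%n p Y (w ℕ.* y) ⟩
        (Y ℕ.+ w ℕ.* y) % p                 ≡⟨ cong (_% p) (regroup w y (p ∸ y)) ⟩
        (w ℕ.+ w ℕ.* ((p ∸ y) ℕ.+ y)) % p   ≡⟨ cong (λ z → (w ℕ.+ w ℕ.* z) % p) (m∸n+n≡m (<⇒≤ y<p)) ⟩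
        (w ℕ.+ w ℕ.* p) % p                 ≡⟨ [m+kn]%n≡m%n w w p ⟩
        w % p                               ∎

    jacobi-scale : ∀ {w} → w % p ≢ 0 → jacobi w ≡ jacobi 1
    jacobi-scale {w} w≢0 = begin
      jacobi w
        ≡⟨ ∑-reindex p (λ y → (w ℕ.* y) % p) (λ y _ → m%n<n (w ℕ.* y) p)
          (λ y y′ y<p y′<p → *-cancelˡ-%-prime p-prime w y y′ p∤w y<p y′<p)
          (λ r → χ r * χ (w -ₚ r)) ⟨
      ∑[ y < p ] χ ((w ℕ.* y) % p) * χ (w -ₚ (w ℕ.* y) % p)
        ≡⟨ ∑-cong p (λ y y<p → term y<p) ⟩
      ∑[ y < p ] (χ w * χ w) * (χ y * χ (1 -ₚ y))
        ≡⟨ ∑-*ˡ p (χ w * χ w) (λ y → χ y * χ (1 -ₚ y)) ⟩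
      (χ w * χ w) * jacobi 1
        ≡⟨ cong (_* jacobi 1) (χ² w≢0) ⟩
      + 1 * jacobi 1
        ≡⟨ ℤ.*-identityˡ (jacobi 1) ⟩
      jacobi 1
        ∎
      where
      open ≡-Reasoning
      p∤w : ¬ p ∣ w
      p∤w p∣w = w≢0 (n∣m⇒m%n≡0 w p p∣w)
      regroup : ∀ (a b c d : ℤ) → (a * b) * (a * d) ≡ (a * a) * (b * d)
      regroup = solve-∀
      term : ∀ {y} → y < p → χ ((w ℕ.* y) % p) * χ (w -ₚ (w ℕ.* y) % p) ≡ (χ w * χ w) * (χ y * χ (1 -ₚ y))
      term {y} y<p = begin
        χ ((w ℕ.* y) % p) * χ (w -ₚ (w ℕ.* y) % p)   ≡⟨ cong₂ _*_ (χ-% (w ℕ.* y))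
                                                          (trans (sym (χ-% _)) (trans (cong χ (-ₚ-*ˡ w y<p)) (χ-% _))) ⟩
        χ (w ℕ.* y) * χ (w ℕ.* (1 -ₚ y))              ≡⟨ cong₂ _*_ (χ-* w y) (χ-* w (1 -ₚ y)) ⟩
        (χ w * χ y) * (χ w * χ (1 -ₚ y))              ≡⟨ regroup (χ w) (χ y) (χ w) (χ (1 -ₚ y)) ⟩
        (χ w * χ w) * (χ y * χ (1 -ₚ y))              ∎

    ∑χ²≡p∸1 : ∑[ r < p ] χ r * χ r ≡ + (p ∸ 1)
    ∑χ²≡p∸1 = begin
      ∑[ r < p ] χ r * χ r                       ≡⟨ ∑-cong p (λ r r<p → trans (χr²≡1-𝟙 r<p) (sym (ℤ.*-identityˡ _))) ⟩
      ∑[ r < p ] + 1 * (+ 1 - 𝟙 (r ℕ.≟ 0))       ≡⟨ ∑-except p 0 (λ _ → + 1) 0<p ⟩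
      ∑< p (λ _ → + 1) - + 1                     ≡⟨ cong (_- + 1) (∑-one p) ⟩
      + p - + 1                                  ≡⟨ ℤ.⊖-≥ 1≤p ⟩
      + (p ∸ 1)                                  ∎
      where
      open ≡-Reasoning
      1≤p : 1 ≤ p
      1≤p = <⇒≤ 1<p

    jacobi-0 : jacobi 0 ≡ χ (p ∸ 1) * + (p ∸ 1)
    jacobi-0 = begin
      ∑[ r < p ] χ r * χ (0 -ₚ r)                ≡⟨ ∑-cong p (λ r r<p → term r<p) ⟩
      ∑[ r < p ] χ (p ∸ 1) * (χ r * χ r)         ≡⟨ ∑-*ˡ p (χ (p ∸ 1)) (λ r → χ r * χ r) ⟩
      χ (p ∸ 1) * (∑[ r < p ] χ r * χ r)         ≡⟨ cong (χ (p ∸ 1) *_) ∑χ²≡p∸1 ⟩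
      χ (p ∸ 1) * + (p ∸ 1)                      ∎
      where
      open ≡-Reasoning
      regroup : ∀ (a b : ℤ) → a * (b * a) ≡ b * (a * a)
      regroup = solve-∀
      p∸r≡[p∸1]*r : ∀ {r} → r < p → (p ∸ r) % p ≡ ((p ∸ 1) ℕ.* r) % p
      p∸r≡[p∸1]*r {r} r<p = %-+-cancelʳ p (p ∸ r) ((p ∸ 1) ℕ.* r) r (begin
        (p ∸ r ℕ.+ r) % p                ≡⟨ cong (_% p) (m∸n+n≡m (<⇒≤ r<p)) ⟩
        p % p                            ≡⟨ n%n≡0 p ⟩
        0                                ≡⟨ m*n%n≡0 r p ⟨
        (r ℕ.* p) % p                    ≡⟨ cong (λ z → (r ℕ.* z) % p) (suc-pred p) ⟨
        (r ℕ.* suc (p ∸ 1)) % p          ≡⟨ cong (_% p) (trans (*-suc r (p ∸ 1)) (cong (r ℕ.+_) (*-comm r (p ∸ 1)))) ⟩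
        (r ℕ.+ (p ∸ 1) ℕ.* r) % p        ≡⟨ cong (_% p) (+-comm r ((p ∸ 1) ℕ.* r)) ⟩
        ((p ∸ 1) ℕ.* r ℕ.+ r) % p        ∎)
      term : ∀ {r} → r < p → χ r * χ (0 -ₚ r) ≡ χ (p ∸ 1) * (χ r * χ r)
      term {r} r<p = begin
        χ r * χ ((p ∸ r) % p)            ≡⟨ cong (χ r *_) (trans (cong χ (p∸r≡[p∸1]*r r<p)) (χ-% _)) ⟩
        χ r * χ ((p ∸ 1) ℕ.* r)          ≡⟨ cong (χ r *_) (χ-* (p ∸ 1) r) ⟩
        χ r * (χ (p ∸ 1) * χ r)          ≡⟨ regroup (χ r) (χ (p ∸ 1)) ⟩
        χ (p ∸ 1) * (χ r * χ r)          ∎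

    -- Summing jacobi over w gives jacobi 0 + (p − 1) · jacobi 1 = 0, and jacobi 0 = (p − 1) χ(−1).
    jacobi-unit : ∀ {w} → w % p ≢ 0 → jacobi w ≡ - χ (p ∸ 1)
    jacobi-unit w≢0 = trans (jacobi-scale w≢0) jacobi-1
      where
      open ≡-Reasoning
      instance
        p∸1-nonZero : NonZero (p ∸ 1)
        p∸1-nonZero = ℕ.>-nonZero (m<n⇒0<n∸m 1<p)
      χ[-1] : ℤ
      χ[-1] = χ (p ∸ 1)
      suc-unit : ∀ {w} → w < p ∸ 1 → suc w % p ≢ 0
      suc-unit w<p∸1 e with () ← trans (sym (m<n⇒m%n≡m (subst (suc _ <_) (suc-pred p) (s≤s w<p∸1)))) e
      sum : + (p ∸ 1) * (χ[-1] + jacobi 1) ≡ + (p ∸ 1) * + 0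
      sum = begin
        + (p ∸ 1) * (χ[-1] + jacobi 1)
          ≡⟨ ℤ.*-distribˡ-+ (+ (p ∸ 1)) χ[-1] (jacobi 1) ⟩
        + (p ∸ 1) * χ[-1] + + (p ∸ 1) * jacobi 1
          ≡⟨ cong₂ _+_ (trans (ℤ.*-comm _ χ[-1]) (sym jacobi-0)) (sym (∑-const (p ∸ 1) (jacobi 1))) ⟩
        jacobi 0 + ∑< (p ∸ 1) (λ _ → jacobi 1)
          ≡⟨ cong (_+_ (jacobi 0)) (∑-cong (p ∸ 1) (λ w w<p∸1 → jacobi-scale (suc-unit w<p∸1))) ⟨
        ∑< (suc (p ∸ 1)) jacobi
          ≡⟨ cong (λ n → ∑< n jacobi) (suc-pred p) ⟩
        ∑< p jacobi
          ≡⟨ ∑jacobi≡0 ⟩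
        + 0
          ≡⟨ ℤ.*-zeroʳ (+ (p ∸ 1)) ⟨
        + (p ∸ 1) * + 0
          ∎
      isolate : ∀ (c j : ℤ) → j ≡ - c + (c + j)
      isolate = solve-∀
      jacobi-1 : jacobi 1 ≡ - χ[-1]
      jacobi-1 = begin
        jacobi 1                      ≡⟨ isolate χ[-1] (jacobi 1) ⟩
        - χ[-1] + (χ[-1] + jacobi 1)  ≡⟨ cong (_+_ (- χ[-1])) (ℤ.*-cancelˡ-≡ (+ (p ∸ 1)) _ _ sum) ⟩
        - χ[-1] + + 0                 ≡⟨ ℤ.+-identityʳ (- χ[-1]) ⟩
        - χ[-1]                       ∎

    χ-trichotomy : ∀ a → χ a ≡ + 0 ⊎ Sign (χ a)
    χ-trichotomy a with χ-view a
    ... | divisible _ e    = inj₁ e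
    ... | residue _ _ e    = inj₂ (subst Sign (sym e) plus)
    ... | nonresidue _ _ e = inj₂ (subst Sign (sym e) minus)

    2𝟙≡ : ∀ {v s} → v ≡ + 0 ⊎ Sign v → Sign s → + 2 * 𝟙 (v ℤ.≟ s) ≡ v * v + s * v
    2𝟙≡ (inj₁ refl)  plus  = refl
    2𝟙≡ (inj₁ refl)  minus = refl
    2𝟙≡ (inj₂ plus)  plus  = refl
    2𝟙≡ (inj₂ plus)  minus = refl
    2𝟙≡ (inj₂ minus) plus  = refl
    2𝟙≡ (inj₂ minus) minus = refl

    #pairs : ℤ → ℤ → ℕ → ℤ
    #pairs s₁ s₂ w = ∑[ r < p ] 𝟙 (χ r ℤ.≟ s₁) * 𝟙 (χ (w -ₚ r) ℤ.≟ s₂)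

    ∑χ²χ[w-ₚr]² : ∀ {w} → w % p ≢ 0 → ∑[ r < p ] (χ r * χ r) * (χ (w -ₚ r) * χ (w -ₚ r)) ≡ + (p ∸ 1) - + 1
    ∑χ²χ[w-ₚr]² {w} w≢0 = begin
      ∑[ r < p ] (χ r * χ r) * b² r
        ≡⟨ ∑-cong p (λ r r<p → trans (ℤ.*-comm _ (b² r)) (cong (b² r *_) (χr²≡1-𝟙 r<p))) ⟩
      ∑[ r < p ] b² r * (+ 1 - 𝟙 (r ℕ.≟ 0))
        ≡⟨ ∑-except p 0 b² 0<p ⟩
      ∑< p b² - b² 0
        ≡⟨ cong₂ _-_ ∑b² (trans (cong (λ z → z * z) (χ[w-ₚ0]≡χw w)) (χ² w≢0)) ⟩
      + (p ∸ 1) - + 1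
        ∎
      where
      open ≡-Reasoning
      b² : ℕ → ℤ
      b² r = χ (w -ₚ r) * χ (w -ₚ r)
      ∑b² : ∑< p b² ≡ + (p ∸ 1)
      ∑b² = begin
        ∑< p b²
          ≡⟨ ∑-cong p (λ r r<p → trans (χ[w-ₚr]²≡1-𝟙 w r<p) (sym (ℤ.*-identityˡ _))) ⟩
        ∑[ r < p ] + 1 * (+ 1 - 𝟙 (r ℕ.≟ w % p))
          ≡⟨ ∑-except p (w % p) (λ _ → + 1) (m%n<n w p) ⟩
        ∑< p (λ _ → + 1) - + 1
          ≡⟨ cong (_- + 1) (∑-one p) ⟩
        + p - + 1
          ≡⟨ ℤ.⊖-≥ (<⇒≤ 1<p) ⟩
        + (p ∸ 1)
          ∎

    ∑χ²χ[w-ₚr] : ∀ w → ∑[ r < p ] (χ r * χ r) * χ (w -ₚ r) ≡ + 0 - χ w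
    ∑χ²χ[w-ₚr] w = begin
      ∑[ r < p ] (χ r * χ r) * χ (w -ₚ r)
        ≡⟨ ∑-cong p (λ r r<p → trans (ℤ.*-comm _ (χ (w -ₚ r))) (cong (χ (w -ₚ r) *_) (χr²≡1-𝟙 r<p))) ⟩
      ∑[ r < p ] χ (w -ₚ r) * (+ 1 - 𝟙 (r ℕ.≟ 0)) ≡⟨ ∑-except p 0 (λ r → χ (w -ₚ r)) 0<p ⟩
      ∑< p (λ r → χ (w -ₚ r)) - χ (w -ₚ 0)
        ≡⟨ cong₂ _-_ (∑χ[w-ₚr]≡0 w) (χ[w-ₚ0]≡χw w) ⟩
      + 0 - χ w
        ∎
      where open ≡-Reasoning

    ∑χχ[w-ₚr]² : ∀ w → ∑[ r < p ] χ r * (χ (w -ₚ r) * χ (w -ₚ r)) ≡ + 0 - χ w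
    ∑χχ[w-ₚr]² w = begin
      ∑[ r < p ] χ r * (χ (w -ₚ r) * χ (w -ₚ r))
        ≡⟨ ∑-cong p (λ r r<p → cong (χ r *_) (χ[w-ₚr]²≡1-𝟙 w r<p)) ⟩
      ∑[ r < p ] χ r * (+ 1 - 𝟙 (r ℕ.≟ w % p))
        ≡⟨ ∑-except p (w % p) χ (m%n<n w p) ⟩
      ∑< p χ - χ (w % p)
        ≡⟨ cong₂ _-_ ∑χ≡0 (χ-% w) ⟩
      + 0 - χ w
          ∎
      where open ≡-Reasoning

    4#pairs-expanded : ∀ {s₁ s₂ w} → Sign s₁ → Sign s₂ → w % p ≢ 0 →
              + 4 * #pairs s₁ s₂ w ≡ (+ (p ∸ 1) - + 1) - (s₁ + s₂) * χ w - s₁ * s₂ * χ (p ∸ 1)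
    4#pairs-expanded {s₁} {s₂} {w} sign₁ sign₂ w≢0 = begin
      + 4 * #pairs s₁ s₂ w
        ≡⟨ ∑-*ˡ p (+ 4) _ ⟨
      ∑[ r < p ] + 4 * (𝟙 (a r ℤ.≟ s₁) * 𝟙 (b r ℤ.≟ s₂))
        ≡⟨ ∑-cong p (λ r _ → expand-𝟙 r) ⟩
      ∑[ r < p ] A r + s₂ * B r + s₁ * C r + s₁ * s₂ * D r
        ≡⟨ ∑-linear p _ (s₁ * s₂) D ⟩
      ∑< p (λ r → A r + s₂ * B r + s₁ * C r) + s₁ * s₂ * ∑< p D
        ≡⟨ cong (_+ s₁ * s₂ * ∑< p D) (trans (∑-linear p _ s₁ C) (cong (_+ s₁ * ∑< p C) (∑-linear p A s₂ B))) ⟩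
      ∑< p A + s₂ * ∑< p B + s₁ * ∑< p C + s₁ * s₂ * ∑< p D
        ≡⟨ cong₂ (λ u v → u + s₂ * v + s₁ * ∑< p C + s₁ * s₂ * ∑< p D) (∑χ²χ[w-ₚr]² w≢0) (∑χ²χ[w-ₚr] w) ⟩
      (+ (p ∸ 1) - + 1) + s₂ * (+ 0 - χ w) + s₁ * ∑< p C + s₁ * s₂ * ∑< p D
        ≡⟨ cong₂ (λ u v → (+ (p ∸ 1) - + 1) + s₂ * (+ 0 - χ w) + s₁ * u + s₁ * s₂ * v) (∑χχ[w-ₚr]² w) (jacobi-unit w≢0) ⟩
      (+ (p ∸ 1) - + 1) + s₂ * (+ 0 - χ w) + s₁ * (+ 0 - χ w) + s₁ * s₂ * - χ (p ∸ 1)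
        ≡⟨ collect (+ (p ∸ 1)) s₁ s₂ (χ w) (χ (p ∸ 1)) ⟩
      (+ (p ∸ 1) - + 1) - (s₁ + s₂) * χ w - s₁ * s₂ * χ (p ∸ 1)
        ∎
      where
      open ≡-Reasoning
      a b A B C D : ℕ → ℤ
      a r = χ r
      b r = χ (w -ₚ r)
      A r = (a r * a r) * (b r * b r)
      B r = (a r * a r) * b r
      C r = a r * (b r * b r)
      D r = a r * b r
      expand-𝟙 : ∀ r → + 4 * (𝟙 (a r ℤ.≟ s₁) * 𝟙 (b r ℤ.≟ s₂)) ≡ A r + s₂ * B r + s₁ * C r + s₁ * s₂ * D r
      expand-𝟙 r = 4ij≡ (a r) (b r) s₁ s₂ (2𝟙≡ (χ-trichotomy r) sign₁) (2𝟙≡ (χ-trichotomy (w -ₚ r)) sign₂)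
      collect : ∀ P s t x c → (P - + 1) + t * (+ 0 - x) + s * (+ 0 - x) + s * t * - c ≡ (P - + 1) - (s + t) * x - s * t * c
      collect = solve-∀

    p%4+χ[-1]≡2 : + (p % 4) + χ (p ∸ 1) ≡ + 2
    p%4+χ[-1]≡2 = [n%4]+s≡2 (#pairs -[1+ 0 ] -[1+ 0 ] 1) (χ-sign [p∸1]%p≢0) (begin
      + p - χ (p ∸ 1)                        ≡⟨ cong (λ n → + n - χ (p ∸ 1)) (suc-pred p) ⟨
      + 1 + + (p ∸ 1) - χ (p ∸ 1)            ≡⟨ simplify (+ (p ∸ 1)) (χ (p ∸ 1)) ⟩
      (+ (p ∸ 1) - + 1) - (-[1+ 0 ] + -[1+ 0 ]) * + 1 - -[1+ 0 ] * -[1+ 0 ] * χ (p ∸ 1)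
                                             ≡⟨ cong (λ x → (+ (p ∸ 1) - + 1) - (-[1+ 0 ] + -[1+ 0 ]) * x - + 1 * χ (p ∸ 1)) χ1≡+1 ⟨
      (+ (p ∸ 1) - + 1) - (-[1+ 0 ] + -[1+ 0 ]) * χ 1 - -[1+ 0 ] * -[1+ 0 ] * χ (p ∸ 1)
                                             ≡⟨ 4#pairs-expanded minus minus 1%p≢0 ⟨
      + 4 * #pairs -[1+ 0 ] -[1+ 0 ] 1       ∎)
      where
      open ≡-Reasoning
      [p∸1]%p≢0 : (p ∸ 1) % p ≢ 0
      [p∸1]%p≢0 e = <⇒≢ (m<n⇒0<n∸m 1<p) (sym (trans (sym (m<n⇒m%n≡m (∸-monoʳ-< {o = 0} (s≤s z≤n) (<⇒≤ 1<p)))) e))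
      simplify : ∀ P c → + 1 + P - c ≡ (P - + 1) - (-[1+ 0 ] + -[1+ 0 ]) * + 1 - -[1+ 0 ] * -[1+ 0 ] * c
      simplify = solve-∀

    4#pairs≡ : ∀ {s₁ s₂ w} → Sign s₁ → Sign s₂ → w % p ≢ 0 →
               + 4 * #pairs s₁ s₂ w ≡ (+ p - + (p % 4)) - (s₁ + s₂) * (χ (p ∸ 1) * s₁ + χ w)
    4#pairs≡ {s₁} {s₂} {w} sign₁ sign₂ w≢0 = begin
      + 4 * #pairs s₁ s₂ w
        ≡⟨ 4#pairs-expanded sign₁ sign₂ w≢0 ⟩
      (P - + 1) - (s₁ + s₂) * x - s₁ * s₂ * c
        ≡⟨ regroup P s₁ s₂ x c ⟩
      main + c * (s₁ * s₁ - + 1)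
        ≡⟨ cong (λ z → main + c * (z - + 1)) (sign² sign₁) ⟩
      main + c * + 0
        ≡⟨ trans (cong (_+_ main) (ℤ.*-zeroʳ c)) (ℤ.+-identityʳ main) ⟩
      main
        ≡⟨ cong₂ (λ n r → (+ n - r) - (s₁ + s₂) * (c * s₁ + x)) (suc-pred p) p%4≡2-c ⟩
      (+ p - + (p % 4)) - (s₁ + s₂) * (c * s₁ + x)
        ∎
      where
      open ≡-Reasoning
      P x c : ℤ
      P = + (p ∸ 1)
      x = χ w
      c = χ (p ∸ 1)
      main : ℤ
      main = (+ 1 + P - (+ 2 - c)) - (s₁ + s₂) * (c * s₁ + x)
      regroup : ∀ P s t x c → (P - + 1) - (s + t) * x - s * t * c
                ≡ (+ 1 + P - (+ 2 - c)) - (s + t) * (c * s + x) + c * (s * s - + 1)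
      regroup = solve-∀
      p%4≡2-c : + 2 - c ≡ + (p % 4)
      p%4≡2-c = trans (cong (_- c) (sym p%4+χ[-1]≡2)) (move (+ (p % 4)) c)
        where
        move : ∀ r c → r + c - c ≡ r
        move = solve-∀

module PAdicValuation where

  open import Defs using (fin; ordF; copF; ord; cop)
  open import Data.Nat using (ℕ; zero; suc; _<_; _≤_; z≤n; s≤s; _*_; _^_; _%_; _/_; NonZero; ≢-nonZero; >-nonZero)
  open import Data.Nat.Properties
  open import Data.Nat.DivMod using (m*n%n≡0; m*n/n≡m)
  open import Data.Nat.Divisibility using (_∣_; _∣?_; divides; _∣0; m%n≡0⇒n∣m)
  open import Data.Bool using (true; false; if_then_else_)
  open import Data.Product using (_×_; _,_; proj₁; proj₂; ∃; ∃₂)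
  open import Data.Empty using (⊥-elim)
  open import Relation.Nullary using (yes; no; does; ¬_)
  open import Relation.Nullary.Decidable using (dec-true; dec-false)
  open import Relation.Binary.PropositionalEquality

  n<m^n : ∀ {m} → 1 < m → ∀ n → n < m ^ n
  n<m^n 1<m zero    = s≤s z≤n
  n<m^n {m} 1<m (suc n) = ≤-<-trans (n<m^n 1<m n) (subst (m ^ n <_) (*-comm (m ^ n) m) (m<m*n (m ^ n) m 1<m))
    where
    instance
      m^n-nonZero : NonZero (m ^ n)
      m^n-nonZero = m^n≢0 m n {{>-nonZero (<-trans (s≤s z≤n) 1<m)}}

  private
    if-true : ∀ {b} {x y : ℕ} → b ≡ true → (if b then x else y) ≡ x
    if-true refl = refl

    if-false : ∀ {b} {x y : ℕ} → b ≡ false → (if b then x else y) ≡ y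
    if-false refl = refl

    ordF-copF-factorised : ∀ {p} → 1 < p → ∀ e c f → ¬ p ∣ c → e < f →
                           ordF f p (p ^ e * c) ≡ e × copF f p (p ^ e * c) ≡ c
    ordF-copF-factorised {p@(suc (suc _))} _ zero c (suc f) p∤c _ =
      if-false last-step , trans (if-false last-step) (*-identityˡ c)
      where
      last-step : does ((1 * c) % p ≟ 0) ≡ false
      last-step = dec-false ((1 * c) % p ≟ 0) (λ e → p∤c (m%n≡0⇒n∣m c p (trans (cong (_% p) (sym (*-identityˡ c))) e)))
    ordF-copF-factorised {p@(suc (suc _))} 1<p (suc e) c (suc f) p∤c (s≤s e<f) =
      trans (if-true divisible-step) (cong suc (trans (cong (ordF f p) divide) (proj₁ rest))) ,
      trans (if-true divisible-step) (trans (cong (copF f p) divide) (proj₂ rest))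
      where
      x : ℕ
      x = p ^ suc e * c
      x≡ : x ≡ (p ^ e * c) * p
      x≡ = trans (*-assoc p (p ^ e) c) (*-comm p (p ^ e * c))
      divisible-step : does (x % p ≟ 0) ≡ true
      divisible-step = dec-true (x % p ≟ 0) (trans (cong (_% p) x≡) (m*n%n≡0 (p ^ e * c) p))
      divide : x / p ≡ p ^ e * c
      divide = trans (cong (_/ p) x≡) (m*n/n≡m (p ^ e * c) p)
      rest : ordF f p (p ^ e * c) ≡ e × copF f p (p ^ e * c) ≡ c
      rest = ordF-copF-factorised 1<p e c f p∤c e<f
    ordF-copF-factorised {suc zero} (s≤s ()) _ _ _ _ _

  ord-cop-factorised : ∀ {p} → 1 < p → ∀ {x} e c → x ≡ p ^ e * c → ¬ p ∣ c → ord p x ≡ fin e × cop p x ≡ c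
  ord-cop-factorised {p} 1<p e c refl p∤c with p ^ e * c | e<p^e*c | ordF-copF-factorised 1<p e c (p ^ e * c) p∤c e<p^e*c
    where
    e<p^e*c : e < p ^ e * c
    e<p^e*c = ≤-trans (n<m^n 1<p e) (m≤m*n (p ^ e) c {{≢-nonZero (λ { refl → p∤c (p ∣0) })}})
  ... | suc _ | _ | ordF≡e , copF≡c = cong fin ordF≡e , copF≡c

  factorise : ∀ {p} → 1 < p → ∀ x → x ≢ 0 → ∃₂ λ e c → x ≡ p ^ e * c × ¬ p ∣ c
  factorise {p} 1<p x = by-fuel x x ≤-refl
    where
    by-fuel : ∀ f x → x ≤ f → x ≢ 0 → ∃₂ λ e c → x ≡ p ^ e * c × ¬ p ∣ c
    by-fuel f x x≤f x≢0 with p ∣? x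
    ... | no p∤x = 0 , x , sym (*-identityˡ x) , p∤x
    by-fuel zero x x≤f x≢0 | yes _ = ⊥-elim (x≢0 (n≤0⇒n≡0 x≤f))
    by-fuel (suc f) x x≤f x≢0 | yes (divides k x≡k*p) with by-fuel f k k≤f k≢0
      where
      k≢0 : k ≢ 0
      k≢0 refl = x≢0 x≡k*p
      k≤f : k ≤ f
      k≤f = ≤-pred (≤-trans (subst (k <_) (sym x≡k*p) (m<m*n k p {{≢-nonZero k≢0}} 1<p)) x≤f)
    ... | e , c , k≡ , p∤c = suc e , c , trans x≡k*p (trans (cong (_* p) k≡)
                               (trans (*-comm (p ^ e * c) p) (sym (*-assoc p (p ^ e) c)))) , p∤c

  ord≡fin⇒factorised : ∀ {p} → 1 < p → ∀ {x i} → ord p x ≡ fin i → ∃ λ c → x ≡ p ^ i * c × ¬ p ∣ c × cop p x ≡ c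
  ord≡fin⇒factorised 1<p {zero} ()
  ord≡fin⇒factorised 1<p {x@(suc _)} ord≡i with factorise 1<p x (λ ())
  ... | e , c , x≡ , p∤c with ord-cop-factorised 1<p e c x≡ p∤c
  ...   | ord≡e , cop≡c with trans (sym ord≡e) ord≡i
  ...     | refl = c , x≡ , p∤c , cop≡c

module PairCounting where

  open import Defs renaming (sym to symbol)
  open FiniteSums
  open ModularArithmetic
  open LegendreSymbol
  open PAdicValuation
  open import Data.Nat as ℕ
    using (ℕ; zero; suc; _<_; _≤_; z≤n; s≤s; _+_; _*_; _∸_; _^_; _%_; _/_; NonZero; >-nonZero; ≢-nonZero⁻¹)
  open import Data.Nat.Properties
  open import Data.Nat.DivMod
  open import Data.Nat.Divisibility
  open import Data.Nat.Primality using (Prime)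
  open import Data.Nat.Tactic.RingSolver using (solve-∀)
  open import Data.Integer as ℤ using (ℤ; +_; -[1+_])
  import Data.Integer.Properties as ℤ
  import Data.Integer.DivMod as ℤ
  import Data.Integer.Tactic.RingSolver as ℤ-Solver
  open import Data.Bool using (if_then_else_)
  open import Data.List using (List; []; _∷_; _++_; map; filter; length; upTo; applyUpTo; cartesianProduct)
  open import Data.Product using (_×_; _,_; proj₁; proj₂; ∃)
  open import Data.Empty using (⊥-elim)
  open import Data.Sum using (inj₁; inj₂)
  open import Function using (_∘_)
  open import Relation.Nullary using (Dec; yes; no; ¬_)
  open import Relation.Nullary.Decidable using (_×-dec_; dec-false)
  open import Relation.Unary using (Decidable)
  open import Relation.Binary.PropositionalEquality

  private
    ∑ˡ : ∀ {A : Set} → (A → ℤ) → List A → ℤ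
    ∑ˡ g []       = + 0
    ∑ˡ g (x ∷ xs) = g x ℤ.+ ∑ˡ g xs

    length-filter : ∀ {A : Set} {P : A → Set} (P? : Decidable P) xs → + length (filter P? xs) ≡ ∑ˡ (𝟙 ∘ P?) xs
    length-filter P? [] = refl
    length-filter P? (x ∷ xs) with P? x
    ... | yes _ = cong (ℤ._+_ (+ 1)) (length-filter P? xs)
    ... | no _  = trans (length-filter P? xs) (sym (ℤ.+-identityˡ _))

    ∑ˡ-++ : ∀ {A : Set} (g : A → ℤ) xs ys → ∑ˡ g (xs ++ ys) ≡ ∑ˡ g xs ℤ.+ ∑ˡ g ys
    ∑ˡ-++ g []       ys = sym (ℤ.+-identityˡ _)
    ∑ˡ-++ g (x ∷ xs) ys = trans (cong (ℤ._+_ (g x)) (∑ˡ-++ g xs ys)) (sym (ℤ.+-assoc (g x) _ _))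

    ∑ˡ-map : ∀ {A B : Set} (g : B → ℤ) (h : A → B) xs → ∑ˡ g (map h xs) ≡ ∑ˡ (g ∘ h) xs
    ∑ˡ-map g h []       = refl
    ∑ˡ-map g h (x ∷ xs) = cong (ℤ._+_ (g (h x))) (∑ˡ-map g h xs)

    ∑ˡ-applyUpTo : ∀ (g : ℕ → ℤ) f n → ∑ˡ g (applyUpTo f n) ≡ ∑< n (g ∘ f)
    ∑ˡ-applyUpTo g f zero    = refl
    ∑ˡ-applyUpTo g f (suc n) = cong (ℤ._+_ (g (f 0))) (∑ˡ-applyUpTo g (f ∘ suc) n)

    ∑ˡ-cartesianProduct : ∀ (g : ℕ × ℕ → ℤ) f n (ys : List ℕ) →
                          ∑ˡ g (cartesianProduct (applyUpTo f n) ys) ≡ ∑[ a < n ] ∑ˡ (λ y → g (f a , y)) ys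
    ∑ˡ-cartesianProduct g f zero    ys = refl
    ∑ˡ-cartesianProduct g f (suc n) ys = trans (∑ˡ-++ g (map (f 0 ,_) ys) _)
      (cong₂ ℤ._+_ (∑ˡ-map g (f 0 ,_) ys) (∑ˡ-cartesianProduct g (f ∘ suc) n ys))

  count≡∑∑𝟙 : ∀ {P : ℕ × ℕ → Set} (P? : Decidable P) n m →
              + length (filter P? (cartesianProduct (upTo n) (upTo m))) ≡ ∑[ a < n ] ∑[ b < m ] 𝟙 (P? (a , b))
  count≡∑∑𝟙 P? n m =
    trans (length-filter P? (cartesianProduct (upTo n) (upTo m)))
          (trans (∑ˡ-cartesianProduct (𝟙 ∘ P?) (λ a → a) n (upTo m))
                 (∑-cong n (λ a _ → ∑ˡ-applyUpTo (λ b → 𝟙 (P? (a , b))) (λ b → b) m)))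

  ∑-pick-complement : ∀ Q .{{_ : NonZero Q}} {a T} (g : ℕ → ℤ) → a < Q → T < Q →
                      ∑[ b < Q ] g b ℤ.* 𝟙 ((a + b) % Q ℕ.≟ T) ≡ g ((T + (Q ∸ a)) % Q)
  ∑-pick-complement Q {a} {T} g a<Q T<Q =
    trans (∑-cong Q (λ b b<Q → cong (g b ℤ.*_)
             (𝟙-cong ((a + b) % Q ℕ.≟ T) (b ℕ.≟ b₀) (solution b<Q) (λ { refl → b₀-solves }))))
          (∑-pick Q b₀ g (m%n<n _ Q))
    where
    open ≡-Reasoning
    b₀ : ℕ
    b₀ = (T + (Q ∸ a)) % Q
    regroup : ∀ a T z → a + (T + z) ≡ T + (z + a)
    regroup = solve-∀
    b₀-solves : (a + b₀) % Q ≡ T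
    b₀-solves = begin
      (a + b₀) % Q                  ≡⟨ [m+o%n]%n≡[m+o]%n Q a (T + (Q ∸ a)) ⟩
      (a + (T + (Q ∸ a))) % Q       ≡⟨ cong (_% Q) (regroup a T (Q ∸ a)) ⟩
      (T + ((Q ∸ a) + a)) % Q       ≡⟨ cong (λ x → (T + x) % Q) (m∸n+n≡m (<⇒≤ a<Q)) ⟩
      (T + Q) % Q                   ≡⟨ [m+n]%n≡m%n T Q ⟩
      T % Q                         ≡⟨ m<n⇒m%n≡m T<Q ⟩
      T                             ∎
    solution : ∀ {b} → b < Q → (a + b) % Q ≡ T → b ≡ b₀
    solution {b} b<Q e = %-+-cancelʳ-< Q b b₀ a b<Q (m%n<n _ Q)
      (trans (cong (_% Q) (+-comm b a)) (trans e (trans (sym b₀-solves) (cong (_% Q) (+-comm a b₀)))))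

  modPK≡%ℕ : ∀ p k t .{{_ : NonZero p}} → modPK p k t ≡ (t ℤ.%ℕ (p ^ k)) {{m^n≢0 p k}}
  modPK≡%ℕ p k t with p ^ k | m^n≢0 p k
  ... | zero  | ()
  ... | suc _ | _ = refl

  module PrimePower {p : ℕ} (1<p : 1 < p) (k i : ℕ) (i<k : i < k) where

    instance
      p-nonZero : NonZero p
      p-nonZero = >-nonZero (<-trans (s≤s z≤n) 1<p)

    Q M m : ℕ
    Q = p ^ k
    M = p ^ i
    m = p * M

    instance
      Q-nonZero : NonZero Q
      Q-nonZero = m^n≢0 p k
      M-nonZero : NonZero M
      M-nonZero = m^n≢0 p i
      m-nonZero : NonZero m
      m-nonZero = m^n≢0 p (suc i)

    Q≡m*p^[k∸i∸1] : Q ≡ m * p ^ (k ∸ i ∸ 1)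
    Q≡m*p^[k∸i∸1] = begin
      p ^ k                          ≡⟨ cong (p ^_) (m+[n∸m]≡n i<k) ⟨
      p ^ (suc i + (k ∸ suc i))      ≡⟨ ^-distribˡ-+-* p (suc i) (k ∸ suc i) ⟩
      m * p ^ (k ∸ suc i)            ≡⟨ cong (λ e → m * p ^ e) (trans (∸-+-assoc k i 1) (cong (k ∸_) (+-comm i 1))) ⟨
      m * p ^ (k ∸ i ∸ 1)            ∎
      where open ≡-Reasoning

    m∣Q : m ∣ Q
    m∣Q = divides (p ^ (k ∸ i ∸ 1)) (trans Q≡m*p^[k∸i∸1] (*-comm m _))

    modPK-< : ∀ t → modPK p k t < Q
    modPK-< t = subst (_< Q) (sym (modPK≡%ℕ p k t)) (ℤ.n%ℕd<d t Q)

    modPK[+n]≡n%Q : ∀ n → modPK p k (+ n) ≡ n % Q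
    modPK[+n]≡n%Q n = modPK≡%ℕ p k (+ n)

    symbol-< : ∀ {x} → x < Q → symbol p k (+ x) ≡ (ord p x , sgn p x)
    symbol-< x<Q = cong (λ y → ord p y , sgn p y) (trans (modPK[+n]≡n%Q _) (m<n⇒m%n≡m x<Q))

    ord≡i⇒factorised : ∀ {y} → ord p y ≡ fin i → ∃ λ c → y ≡ M * c × ¬ p ∣ c × cop p y ≡ c
    ord≡i⇒factorised = ord≡fin⇒factorised 1<p

    [M*c]%m≡[c%p]*M : ∀ c → (M * c) % m ≡ (c % p) * M
    [M*c]%m≡[c%p]*M c = trans (cong (_% m) (*-comm M c)) (sym (m%n*o≡m*o%[n*o] c p M))

    symbol-factorisation : ∀ {t γ} → symbol p k t ≡ γ → ordS γ ≡ fin i →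
                           ∃ λ c → modPK p k t ≡ M * c × ¬ p ∣ c × sgnS γ ≡ sgn p (modPK p k t) × cop p (modPK p k t) ≡ c
    symbol-factorisation sym≡γ ord≡i with ord≡i⇒factorised (trans (cong proj₁ sym≡γ) ord≡i)
    ... | c , T≡ , p∤c , cop≡c = c , T≡ , p∤c , sym (cong proj₂ sym≡γ) , cop≡c

  module OddPrime {p : ℕ} (p-prime : Prime p) (p≢2 : p ≢ 2) (k i : ℕ) (i<k : i < k) where

    open AtOddPrime p-prime p≢2 hiding (p-nonZero)
    open PrimePower 1<p k i i<k

    sgn≡χ∘cop : ∀ {y} → y ≢ 0 → sgn p y ≡ χ (cop p y)
    sgn≡χ∘cop {zero}  y≢0 = ⊥-elim (y≢0 refl)
    sgn≡χ∘cop {suc y} _   =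
      cong (λ b → if b then + (cop p (suc y) % 8) else χ (cop p (suc y))) (dec-false (p ℕ.≟ 2) p≢2)

    sgn-factorised : ∀ {y c} → y ≡ M * c → ¬ p ∣ c → cop p y ≡ c → sgn p y ≡ χ c
    sgn-factorised {y} {c} y≡M*c p∤c cop≡c = trans (sgn≡χ∘cop y≢0) (cong χ cop≡c)
      where
      y≢0 : y ≢ 0
      y≢0 y≡0 with m*n≡0⇒m≡0∨n≡0 M (trans (sym y≡M*c) y≡0)
      ... | inj₁ M≡0 = ≢-nonZero⁻¹ M M≡0
      ... | inj₂ refl = p∤c (p ∣0)

    -- For d = x % m, d % M collects the digits of x below position i and d / M is its i-th base-p digit.
    digits-test : ℤ → ℕ → ℤ
    digits-test s d = 𝟙 (d % M ℕ.≟ 0) ℤ.* 𝟙 (χ (d / M) ℤ.≟ s)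

    symbol≡⇒digits : ∀ {x s} → x < Q → symbol p k (+ x) ≡ (fin i , s) → (x % m) % M ≡ 0 × χ ((x % m) / M) ≡ s
    symbol≡⇒digits {x} {s} x<Q e with ord≡i⇒factorised (cong proj₁ (trans (sym (symbol-< x<Q)) e))
    ... | c , x≡M*c , p∤c , cop≡c =
      trans (%-congˡ x%m≡) (m*n%n≡0 (c % p) M) ,
      (begin
        χ ((x % m) / M)        ≡⟨ cong χ (/-congˡ x%m≡) ⟩
        χ ((c % p) * M / M)    ≡⟨ cong χ (m*n/n≡m (c % p) M) ⟩
        χ (c % p)              ≡⟨ χ-% c ⟩
        χ c                    ≡⟨ sgn-factorised x≡M*c p∤c cop≡c ⟨
        sgn p x                ≡⟨ cong proj₂ (trans (sym (symbol-< x<Q)) e) ⟩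
        s                      ∎)
      where
      open ≡-Reasoning
      x%m≡ : x % m ≡ (c % p) * M
      x%m≡ = trans (%-congˡ x≡M*c) ([M*c]%m≡[c%p]*M c)

    digits⇒symbol≡ : ∀ {x s} → x < Q → Sign s → (x % m) % M ≡ 0 → χ ((x % m) / M) ≡ s → symbol p k (+ x) ≡ (fin i , s)
    digits⇒symbol≡ {x} {s} x<Q sign-s lower≡0 χu≡s =
      trans (symbol-< x<Q) (cong₂ _,_ (proj₁ ord-cop) (trans (sgn-factorised x≡M*c p∤c (proj₂ ord-cop)) χc≡s))
      where
      open ≡-Reasoning
      u c : ℕ
      u = (x % m) / M
      c = u + x / m * p
      regroup : ∀ u y p M → u * M + y * (p * M) ≡ M * (u + y * p)
      regroup = solve-∀
      x≡M*c : x ≡ M * c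
      x≡M*c = begin
        x                               ≡⟨ m≡m%n+[m/n]*n x m ⟩
        x % m + x / m * m               ≡⟨ cong (_+ x / m * m) (m/n*n≡m (m%n≡0⇒n∣m (x % m) M lower≡0)) ⟨
        u * M + x / m * (p * M)         ≡⟨ regroup u (x / m) p M ⟩
        M * c                           ∎
      c%p≡u%p : c % p ≡ u % p
      c%p≡u%p = [m+kn]%n≡m%n u (x / m) p
      u%p≢0 : u % p ≢ 0
      u%p≢0 u%p≡0 = sign≢0 sign-s (trans (sym χu≡s) (χ≡0 u%p≡0))
      p∤c : ¬ p ∣ c
      p∤c p∣c = u%p≢0 (trans (sym c%p≡u%p) (n∣m⇒m%n≡0 c p p∣c))
      ord-cop : ord p x ≡ fin i × cop p x ≡ c
      ord-cop = ord-cop-factorised 1<p i c x≡M*c p∤c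
      χc≡s : χ c ≡ s
      χc≡s = trans (sym (χ-% c)) (trans (cong χ c%p≡u%p) (trans (χ-% u) χu≡s))

    𝟙-symbol≡ : ∀ {x s} → x < Q → Sign s → 𝟙 (symbol p k (+ x) ≟S (fin i , s)) ≡ digits-test s (x % m)
    𝟙-symbol≡ {x} {s} x<Q sign-s =
      trans (𝟙-cong (symbol p k (+ x) ≟S (fin i , s)) (((x % m) % M ℕ.≟ 0) ×-dec (χ ((x % m) / M) ℤ.≟ s))
               (symbol≡⇒digits x<Q) (λ (lower≡0 , χu≡s) → digits⇒symbol≡ x<Q sign-s lower≡0 χu≡s))
            (𝟙-× ((x % m) % M ℕ.≟ 0) (χ ((x % m) / M) ℤ.≟ s))

    digits-test-multiple : ∀ s j → digits-test s (j * M) ≡ 𝟙 (χ j ℤ.≟ s)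
    digits-test-multiple s j = trans
      (cong₂ ℤ._*_ (𝟙-yes ((j * M) % M ℕ.≟ 0) (m*n%n≡0 j M))
                   (cong (λ z → 𝟙 (χ z ℤ.≟ s)) (m*n/n≡m j M)))
      (ℤ.*-identityˡ (𝟙 (χ j ℤ.≟ s)))

    digits-test-non-multiple : ∀ s d → d % M ≢ 0 → digits-test s d ≡ + 0
    digits-test-non-multiple s d d%M≢0 =
      trans (cong (ℤ._* 𝟙 (χ (d / M) ℤ.≟ s)) (𝟙-no (d % M ℕ.≟ 0) d%M≢0)) (ℤ.*-zeroˡ (𝟙 (χ (d / M) ℤ.≟ s)))

    complement%m : ∀ T {a} → a < Q → ((T + (Q ∸ a)) % Q) % m ≡ (T % m + (m ∸ a % m)) % m
    complement%m T {a} a<Q = trans (m∣n⇒o%n%m≡o%m m Q (T + (Q ∸ a)) m∣Q)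
      (%-+-cancelʳ m (T + (Q ∸ a)) (T % m + (m ∸ a % m)) (a % m) (trans lhs (sym rhs)))
      where
      open ≡-Reasoning
      lhs : (T + (Q ∸ a) + a % m) % m ≡ T % m
      lhs = begin
        (T + (Q ∸ a) + a % m) % m        ≡⟨ [m+o%n]%n≡[m+o]%n m (T + (Q ∸ a)) a ⟩
        (T + (Q ∸ a) + a) % m            ≡⟨ %-congˡ (+-assoc T (Q ∸ a) a) ⟩
        (T + ((Q ∸ a) + a)) % m          ≡⟨ cong (λ z → (T + z) % m) (m∸n+n≡m (<⇒≤ a<Q)) ⟩
        (T + Q) % m                      ≡⟨ %-remove-+ʳ T m∣Q ⟩
        T % m                            ∎
      rhs : (T % m + (m ∸ a % m) + a % m) % m ≡ T % m
      rhs = begin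
        (T % m + (m ∸ a % m) + a % m) % m    ≡⟨ %-congˡ (+-assoc (T % m) (m ∸ a % m) (a % m)) ⟩
        (T % m + ((m ∸ a % m) + a % m)) % m  ≡⟨ cong (λ z → (T % m + z) % m) (m∸n+n≡m (<⇒≤ (m%n<n a m))) ⟩
        (T % m + m) % m                      ≡⟨ [m+n]%n≡m%n (T % m) m ⟩
        T % m % m                            ≡⟨ m%n%n≡m%n T m ⟩
        T % m                                ∎

    [w*M+[m∸j*M]]%m≡[w-ₚj]*M : ∀ w j → (w * M + (m ∸ j * M)) % m ≡ (w -ₚ j) * M
    [w*M+[m∸j*M]]%m≡[w-ₚj]*M w j = begin
      (w * M + (p * M ∸ j * M)) % m  ≡⟨ cong (λ z → (w * M + z) % m) (*-distribʳ-∸ M p j) ⟨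
      (w * M + (p ∸ j) * M) % m      ≡⟨ %-congˡ (*-distribʳ-+ M w (p ∸ j)) ⟨
      ((w + (p ∸ j)) * M) % m        ≡⟨ m%n*o≡m*o%[n*o] (w + (p ∸ j)) p M ⟨
      (w -ₚ j) * M                   ∎
      where open ≡-Reasoning

    -- Given a, the pair condition forces b = (T − a) mod Q, whose symbol depends only on a mod m.
    ∑-over-b : ∀ {T w s₁ s₂} → T < Q → T % m ≡ w * M → Sign s₁ → Sign s₂ → ∀ {a} → a < Q →
               ∑[ b < Q ] (𝟙 (symbol p k (+ a) ≟S (fin i , s₁)) ℤ.* 𝟙 (symbol p k (+ b) ≟S (fin i , s₂)))
                            ℤ.* 𝟙 ((a + b) % Q ℕ.≟ T)
               ≡ digits-test s₁ (a % m) ℤ.* digits-test s₂ ((w * M + (m ∸ a % m)) % m)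
    ∑-over-b {T} {w} {s₁} {s₂} T<Q T%m≡ sign₁ sign₂ {a} a<Q = begin
      ∑[ b < Q ] (A ℤ.* B b) ℤ.* 𝟙 ((a + b) % Q ℕ.≟ T)
        ≡⟨ ∑-cong Q (λ b _ → ℤ.*-assoc A (B b) _) ⟩
      ∑[ b < Q ] A ℤ.* (B b ℤ.* 𝟙 ((a + b) % Q ℕ.≟ T))
        ≡⟨ ∑-*ˡ Q A _ ⟩
      A ℤ.* (∑[ b < Q ] B b ℤ.* 𝟙 ((a + b) % Q ℕ.≟ T))
        ≡⟨ cong (A ℤ.*_) (∑-pick-complement Q B a<Q T<Q) ⟩
      A ℤ.* B b₀
        ≡⟨ cong₂ ℤ._*_ (𝟙-symbol≡ a<Q sign₁) (𝟙-symbol≡ (m%n<n _ Q) sign₂) ⟩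
      digits-test s₁ (a % m) ℤ.* digits-test s₂ (b₀ % m)
        ≡⟨ cong (λ z → digits-test s₁ (a % m) ℤ.* digits-test s₂ z) b₀%m≡ ⟩
      digits-test s₁ (a % m) ℤ.* digits-test s₂ ((w * M + (m ∸ a % m)) % m)
        ∎
      where
      open ≡-Reasoning
      A : ℤ
      A = 𝟙 (symbol p k (+ a) ≟S (fin i , s₁))
      B : ℕ → ℤ
      B b = 𝟙 (symbol p k (+ b) ≟S (fin i , s₂))
      b₀ : ℕ
      b₀ = (T + (Q ∸ a)) % Q
      b₀%m≡ : b₀ % m ≡ (w * M + (m ∸ a % m)) % m
      b₀%m≡ = trans (complement%m T a<Q) (cong (λ z → (z + (m ∸ a % m)) % m) T%m≡)

    countPairs≡ : ∀ t {w s₁ s₂} → Sign s₁ → Sign s₂ → modPK p k t % m ≡ w * M →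
                  + countPairs p k t (fin i , s₁) (fin i , s₂) ≡ + (p ^ (k ∸ i ∸ 1)) ℤ.* #pairs s₁ s₂ w
    countPairs≡ t {w} {s₁} {s₂} sign₁ sign₂ T%m≡ = begin
      + countPairs p k t (fin i , s₁) (fin i , s₂)
        ≡⟨ count≡∑∑𝟙 pair? Q Q ⟩
      ∑[ a < Q ] ∑[ b < Q ] 𝟙 (pair? (a , b))
        ≡⟨ ∑-cong Q (λ a a<Q → trans (∑-cong Q (λ b _ → split-𝟙 a b)) (∑-over-b {w = w} (modPK-< t) T%m≡ sign₁ sign₂ a<Q)) ⟩
      ∑[ a < Q ] F (a % m)
        ≡⟨ cong (λ n → ∑[ a < n ] F (a % m)) Q≡m*p^[k∸i∸1] ⟩
      ∑[ a < m * p ^ (k ∸ i ∸ 1) ] F (a % m)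
        ≡⟨ ∑-periodic m (p ^ (k ∸ i ∸ 1)) F ⟩
      + (p ^ (k ∸ i ∸ 1)) ℤ.* ∑< m F
        ≡⟨ cong (+ (p ^ (k ∸ i ∸ 1)) ℤ.*_) (∑-multiples M p F F-non-multiple) ⟩
      + (p ^ (k ∸ i ∸ 1)) ℤ.* (∑[ j < p ] F (j * M))
        ≡⟨ cong (+ (p ^ (k ∸ i ∸ 1)) ℤ.*_) (∑-cong p (λ j _ → F-multiple j)) ⟩
      + (p ^ (k ∸ i ∸ 1)) ℤ.* #pairs s₁ s₂ w
        ∎
      where
      open ≡-Reasoning
      T : ℕ
      T = modPK p k t
      pair? : ∀ (ab : ℕ × ℕ) → Dec (((symbol p k (+ proj₁ ab) ≡ (fin i , s₁)) × (symbol p k (+ proj₂ ab) ≡ (fin i , s₂)))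
                                    × (modPK p k (+ (proj₁ ab + proj₂ ab)) ≡ T))
      pair? (a , b) = ((symbol p k (+ a) ≟S (fin i , s₁)) ×-dec (symbol p k (+ b) ≟S (fin i , s₂)))
                      ×-dec (modPK p k (+ (a + b)) ℕ.≟ T)
      split-𝟙 : ∀ a b → 𝟙 (pair? (a , b)) ≡ (𝟙 (symbol p k (+ a) ≟S (fin i , s₁)) ℤ.* 𝟙 (symbol p k (+ b) ≟S (fin i , s₂)))
                                             ℤ.* 𝟙 ((a + b) % Q ℕ.≟ T)
      split-𝟙 a b = trans (𝟙-× ((symbol p k (+ a) ≟S (fin i , s₁)) ×-dec (symbol p k (+ b) ≟S (fin i , s₂)))
                                (modPK p k (+ (a + b)) ℕ.≟ T))
        (cong₂ ℤ._*_ (𝟙-× (symbol p k (+ a) ≟S (fin i , s₁)) (symbol p k (+ b) ≟S (fin i , s₂)))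
                     (𝟙-cong (modPK p k (+ (a + b)) ℕ.≟ T) ((a + b) % Q ℕ.≟ T)
                             (trans (sym (modPK[+n]≡n%Q (a + b)))) (trans (modPK[+n]≡n%Q (a + b)))))
      F : ℕ → ℤ
      F d = digits-test s₁ d ℤ.* digits-test s₂ ((w * M + (m ∸ d)) % m)
      F-non-multiple : ∀ d → d % M ≢ 0 → F d ≡ + 0
      F-non-multiple d d%M≢0 = trans (cong (ℤ._* G) (digits-test-non-multiple s₁ d d%M≢0)) (ℤ.*-zeroˡ G)
        where
        G : ℤ
        G = digits-test s₂ ((w * M + (m ∸ d)) % m)
      F-multiple : ∀ j → F (j * M) ≡ 𝟙 (χ j ℤ.≟ s₁) ℤ.* 𝟙 (χ (w -ₚ j) ℤ.≟ s₂)
      F-multiple j = cong₂ ℤ._*_ (digits-test-multiple s₁ j)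
        (trans (cong (digits-test s₂) ([w*M+[m∸j*M]]%m≡[w-ₚj]*M w j)) (digits-test-multiple s₂ (w -ₚ j)))

    symbol-digit : ∀ {t γ} → symbol p k t ≡ γ → ordS γ ≡ fin i →
                   ∃ λ w → w % p ≢ 0 × modPK p k t % m ≡ w * M × χ w ≡ sgnS γ
    symbol-digit {t} sym≡γ ord≡i with symbol-factorisation sym≡γ ord≡i
    ... | c , T≡M*c , p∤c , sgn≡ , cop≡c =
      c % p ,
      (λ e → p∤c (m%n≡0⇒n∣m c p (trans (sym (m%n%n≡m%n c p)) e))) ,
      trans (%-congˡ T≡M*c) ([M*c]%m≡[c%p]*M c) ,
      trans (χ-% c) (trans (sym (sgn-factorised T≡M*c p∤c cop≡c)) (sym sgn≡))

    symbol-sign : ∀ {γ} → IsSymbol p k γ → ordS γ ≡ fin i → Sign (sgnS γ)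
    symbol-sign (t , sym≡γ) ord≡i with symbol-digit sym≡γ ord≡i
    ... | w , w≢0 , _ , χw≡ = subst Sign χw≡ (χ-sign w≢0)

    4*countPairs≡ : ∀ (t : ℤ) (γ γ₁ γ₂ : Symbol) → IsSymbol p k γ₁ → IsSymbol p k γ₂ →
                    ordS γ ≡ fin i → ordS γ₁ ≡ fin i → ordS γ₂ ≡ fin i → symbol p k t ≡ γ →
                    + 4 ℤ.* + countPairs p k t γ₁ γ₂
                    ≡ + (p ^ (k ∸ i ∸ 1)) ℤ.* ((+ p ℤ.- + (p % 4))
                         ℤ.- (sgnS γ₁ ℤ.+ sgnS γ₂) ℤ.* (legendre p (p ∸ 1) ℤ.* sgnS γ₁ ℤ.+ sgnS γ))
    4*countPairs≡ t γ γ₁@(_ , s₁) γ₂@(_ , s₂) is₁ is₂ ord≡i refl refl sym≡γ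
      with symbol-digit sym≡γ ord≡i
    ... | w , w≢0 , T%m≡ , χw≡ = begin
      + 4 ℤ.* + countPairs p k t γ₁ γ₂
        ≡⟨ cong (+ 4 ℤ.*_) (countPairs≡ t sign₁ sign₂ T%m≡) ⟩
      + 4 ℤ.* (+ P′ ℤ.* #pairs s₁ s₂ w)
        ≡⟨ swap (+ 4) (+ P′) (#pairs s₁ s₂ w) ⟩
      + P′ ℤ.* (+ 4 ℤ.* #pairs s₁ s₂ w)
        ≡⟨ cong (+ P′ ℤ.*_) (4#pairs≡ sign₁ sign₂ w≢0) ⟩
      + P′ ℤ.* formula (χ w)
        ≡⟨ cong (λ x → + P′ ℤ.* formula x) χw≡ ⟩
      + P′ ℤ.* formula (sgnS γ)
        ∎
      where
      open ≡-Reasoning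
      P′ : ℕ
      P′ = p ^ (k ∸ i ∸ 1)
      formula : ℤ → ℤ
      formula x = (+ p ℤ.- + (p % 4)) ℤ.- (s₁ ℤ.+ s₂) ℤ.* (χ (p ∸ 1) ℤ.* s₁ ℤ.+ x)
      sign₁ : Sign s₁
      sign₁ = symbol-sign is₁ refl
      sign₂ : Sign s₂
      sign₂ = symbol-sign is₂ refl
      swap : ∀ (a b c : ℤ) → a ℤ.* (b ℤ.* c) ≡ b ℤ.* (a ℤ.* c)
      swap = ℤ-Solver.solve-∀

  module EvenPrime (k i : ℕ) (i<k : i < k) where

    open PrimePower {2} (s≤s (s≤s z≤n)) k i i<k

    odd⇒%2≡1 : ∀ {c} → ¬ 2 ∣ c → c % 2 ≡ 1
    odd⇒%2≡1 {c} 2∤c with c % 2 | m%n<n c 2 | m%n≡0⇒n∣m c 2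
    ... | zero        | _               | 2∣c = ⊥-elim (2∤c (2∣c refl))
    ... | suc zero    | _               | _   = refl
    ... | suc (suc _) | s≤s (s≤s ())    | _

    m∣M*[odd+odd] : ∀ {c d} → ¬ 2 ∣ c → ¬ 2 ∣ d → m ∣ M * c + M * d
    m∣M*[odd+odd] {c} {d} 2∤c 2∤d =
      subst₂ _∣_ (*-comm M 2) (*-distribˡ-+ M c d) (*-monoʳ-∣ M 2∣c+d)
      where
      2∣c+d : 2 ∣ c + d
      2∣c+d = m%n≡0⇒n∣m (c + d) 2
        (trans (%-distribˡ-+ c d 2) (cong₂ (λ x y → (x + y) % 2) (odd⇒%2≡1 2∤c) (odd⇒%2≡1 2∤d)))

    no-pair : ∀ {t γ γ₁ γ₂ a b} → ordS γ ≡ fin i → ordS γ₁ ≡ fin i → ordS γ₂ ≡ fin i → symbol 2 k t ≡ γ →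
              a < Q → b < Q →
              ¬ (((symbol 2 k (+ a) ≡ γ₁) × (symbol 2 k (+ b) ≡ γ₂)) × (modPK 2 k (+ (a + b)) ≡ modPK 2 k t))
    no-pair {t} {a = a} {b} ord≡i ord₁≡i ord₂≡i sym≡γ a<Q b<Q ((sym-a≡ , sym-b≡) , sum≡T)
      with symbol-factorisation sym≡γ ord≡i | symbol-factorisation sym-a≡ ord₁≡i | symbol-factorisation sym-b≡ ord₂≡i
    ... | c , T≡M*c , 2∤c , _ | c₁ , a≡M*c₁ , 2∤c₁ , _ | c₂ , b≡M*c₂ , 2∤c₂ , _ =
      2∤c (*-cancelˡ-∣ M (subst₂ _∣_ (*-comm 2 M) T≡M*c m∣T))
      where
      a+b≡ : a + b ≡ M * c₁ + M * c₂
      a+b≡ = cong₂ _+_ (trans (sym (trans (modPK[+n]≡n%Q a) (m<n⇒m%n≡m a<Q))) a≡M*c₁)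
                       (trans (sym (trans (modPK[+n]≡n%Q b) (m<n⇒m%n≡m b<Q))) b≡M*c₂)
      m∣T : m ∣ modPK 2 k t
      m∣T = subst (m ∣_) (trans (sym (modPK[+n]≡n%Q (a + b))) sum≡T)
              (%-presˡ-∣ (subst (m ∣_) (sym a+b≡) (m∣M*[odd+odd] 2∤c₁ 2∤c₂)) m∣Q)

    countPairs≡0 : ∀ (t : ℤ) (γ γ₁ γ₂ : Symbol) → ordS γ ≡ fin i → ordS γ₁ ≡ fin i → ordS γ₂ ≡ fin i →
                   symbol 2 k t ≡ γ → countPairs 2 k t γ₁ γ₂ ≡ 0
    countPairs≡0 t γ γ₁ γ₂ ord≡i ord₁≡i ord₂≡i sym≡γ = ℤ.+-injective (begin
      + countPairs 2 k t γ₁ γ₂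
        ≡⟨ count≡∑∑𝟙 pair? Q Q ⟩
      ∑[ a < Q ] ∑[ b < Q ] 𝟙 (pair? (a , b))
        ≡⟨ ∑-vanishing Q (λ a a<Q → ∑-vanishing Q (λ b b<Q →
             𝟙-no (pair? (a , b)) (no-pair ord≡i ord₁≡i ord₂≡i sym≡γ a<Q b<Q))) ⟩
      + 0
        ∎)
      where
      open ≡-Reasoning
      pair? : ∀ (ab : ℕ × ℕ) → Dec (((symbol 2 k (+ proj₁ ab) ≡ γ₁) × (symbol 2 k (+ proj₂ ab) ≡ γ₂))
                                    × (modPK 2 k (+ (proj₁ ab + proj₂ ab)) ≡ modPK 2 k t))
      pair? (a , b) = ((symbol 2 k (+ a) ≟S γ₁) ×-dec (symbol 2 k (+ b) ≟S γ₂))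
                      ×-dec (modPK 2 k (+ (a + b)) ℕ.≟ modPK 2 k t)

open import Defs
open import Data.Nat using (ℕ; _<_; _≤_; _^_; _∸_; _%_)
open import Data.Nat.Primality using (Prime)
open import Data.Integer using (ℤ; +_; _+_; _-_; _*_)
open import Data.Product using (_×_; _,_)
open import Relation.Binary.PropositionalEquality using (_≡_; _≢_; refl)
open PairCounting using (module OddPrime; module EvenPrime)

lemma17 : (p k i : ℕ) → Prime p → 1 ≤ k →
          (γ γ₁ γ₂ : Symbol) → IsSymbol p k γ₁ → IsSymbol p k γ₂ →
          ordS γ ≡ fin i → ordS γ₁ ≡ fin i → ordS γ₂ ≡ fin i → i < k →
          (t : ℤ) → sym p k t ≡ γ →
          (p ≡ 2 → countPairs p k t γ₁ γ₂ ≡ 0) ×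
          (p ≢ 2 → + 4 * + countPairs p k t γ₁ γ₂
                     ≡ + (p ^ (k ∸ i ∸ 1))
                       * ((+ p - + (p % 4))
                          - (sgnS γ₁ + sgnS γ₂) * (legendre p (p ∸ 1) * sgnS γ₁ + sgnS γ)))
lemma17 p k i p-prime _ γ γ₁ γ₂ is₁ is₂ ord≡i ord₁≡i ord₂≡i i<k t sym≡γ = even , odd
  where
  even : p ≡ 2 → countPairs p k t γ₁ γ₂ ≡ 0
  even refl = EvenPrime.countPairs≡0 k i i<k t γ γ₁ γ₂ ord≡i ord₁≡i ord₂≡i sym≡γ
  odd : p ≢ 2 → + 4 * + countPairs p k t γ₁ γ₂
                ≡ + (p ^ (k ∸ i ∸ 1)) * ((+ p - + (p % 4)) - (sgnS γ₁ + sgnS γ₂) * (legendre p (p ∸ 1) * sgnS γ₁ + sgnS γ))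
  odd p≢2 = OddPrime.4*countPairs≡ p-prime p≢2 k i i<k t γ γ₁ γ₂ is₁ is₂ ord≡i ord₁≡i ord₂≡i sym≡γ
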